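{- For every integer $n\ge1$, modulo $2$: (1) $a_n\equiv1$ if $n\equiv0,1,2,5,8,9\pmod{10}$ and $a_n\equiv0$ otherwise; (2) $b_n\equiv1$ if $n\equiv2,4,6,8\pmod{10}$ and $0$ otherwise; (3) $c_n\equiv1$ if $n\equiv1,5,9\pmod{10}$ and $0$ otherwise; (4) $d_n\equiv1$ if $n\equiv2,3,4,5,6,7,8\pmod{10}$ and $0$ otherwise; (5) $e_n\equiv1$ if $n\equiv2,5,8\pmod{10}$ and $0$ otherwise; (6) $g_n\equiv1$ if $n\equiv0,1,8,9\pmod{10}$ and $0$ otherwise; (7) $h_n\equiv1$ if $n\equiv1,2,4,5,7,8\pmod{10}$ and $0$ otherwise; (8) $x_n\equiv1$ if $n\equiv1,4,5,8\pmod{10}$ and $0$ otherwise; (9) $y_n\equiv1$ if $n\equiv2,3,4,5,6,7\pmod{10}$ and $0$ otherwise. In particular the sequence of Hankel determinants $a_n=H_n(F)$ of the regular paperfolding sequence is periodic modulo $2$ with period $10$.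
   Context: Let $\mathbf f=f_0f_1f_2\cdots$ be the regular paperfolding sequence, defined by $f_{4n}=1$, $f_{4n+2}=0$, $f_{2n+1}=f_n$ ($n\ge0$), with generating function $F(z)=\sum_{i\ge0}f_iz^i$. For $m,n\ge1$ let $\mathbf f^0_{m,n}=(f_{i+j-2})_{1\le i\le m,\,1\le j\le n}$ and $\mathbf f^0_n=\mathbf f^0_{n,n}$. Let $\alpha(n)=(1,0,1,0,\dots)$ and $\beta(n)=(0,1,0,1,\dots)$ be the $1\times n$ alternating row vectors starting with $1$ resp. $0$; $v^t$ is transpose, $|M|$ the determinant. Define $a_n=|\mathbf f^0_n|$, $b_n=\left|\begin{smallmatrix}\mathbf f^0_n&\alpha^t(n)&\beta^t(n)\\ \alpha(n)&0&0\\ \beta(n)&0&0\end{smallmatrix}\right|$, $c_n=\left|\begin{smallmatrix}\mathbf f^0_n&\alpha^t(n)\\ \alpha(n)&0\end{smallmatrix}\right|$, $d_n=\left|\begin{smallmatrix}\mathbf f^0_n&\beta^t(n)\\ \beta(n)&0\end{smallmatrix}\right|$, $e_n=\left|\begin{smallmatrix}\mathbf f^0_n&\beta^t(n)\\ \alpha(n)&0\end{smallmatrix}\right|$, $g_n=|\mathbf f^0_{n+1,n}\ \alpha^t(n+1)|$, $h_n=|\mathbf f^0_{n+1,n}\ \beta^t(n+1)|$, $x_n=\left|\begin{smallmatrix}\mathbf f^0_{n+1,n}&\alpha^t(n+1)&\beta^t(n+1)\\ \alpha(n)&0&0\end{smallmatrix}\right|$, $y_n=\left|\begin{smallmatrix}\mathbf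 f^0_{n+1,n}&\alpha^t(n+1)&\beta^t(n+1)\\ \beta(n)&0&0\end{smallmatrix}\right|$. Thus $a_n=H_n(F)$, the Hankel determinant of order $n$ of $\mathbf f$. -}

module Defs where

open import Data.Nat using (ℕ; zero; suc; _+_; _*_; _%_; _/_; _≡ᵇ_; _<ᵇ_)
open import Data.Integer using (ℤ; +_; -_) renaming (_+_ to _+ℤ_; _*_ to _*ℤ_)
open import Data.Fin using (Fin; toℕ; punchIn) renaming (zero to fzero; suc to fsuc)
open import Data.Bool using (Bool; true; false; if_then_else_)
open import Data.List using (List)
open import Data.Bool.ListAction using (any)

-- Implemented with a fuel argument (fuel n+1 suffices for index n,
-- since each recursive step maps n ≥ 1 to ⌊n/2⌋ < n).

pfAux : ℕ → ℕ → ℤ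
pfAux zero    n = + 0
pfAux (suc k) n with n % 4
... | 0 = + 1
... | 2 = + 0
... | _ = pfAux k (n / 2)   -- n odd: f n = f ((n-1)/2) = f (n / 2)

pf : ℕ → ℤ
pf n = pfAux (suc n) n

sumFin : ∀ {n} → (Fin n → ℤ) → ℤ
sumFin {zero}  g = + 0
sumFin {suc n} g = g fzero +ℤ sumFin (λ j → g (fsuc j))

sign : ℕ → ℤ
sign zero          = + 1
sign (suc zero)    = - (+ 1)
sign (suc (suc k)) = sign k

det : (n : ℕ) → (Fin n → Fin n → ℤ) → ℤ
det zero    M = + 1
det (suc n) M =
  sumFin (λ j → sign (toℕ j) *ℤ M fzero j *ℤ det n (λ i k → M (fsuc i) (punchIn j k)))

detℕ : (k : ℕ) → (ℕ → ℕ → ℤ) → ℤ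
detℕ k M = det k (λ i j → M (toℕ i) (toℕ j))

α : ℕ → ℤ
α i = if i % 2 ≡ᵇ 0 then + 1 else + 0

β : ℕ → ℤ
β i = if i % 2 ≡ᵇ 0 then + 0 else + 1

-- Entries (0-indexed) of f⁰ : (f⁰)_{ij} = f (i + j).
-- Bordered matrices: the Hankel block occupies rows < r, columns < c;
-- the remaining rows/columns are given explicitly.

a : ℕ → ℤ
a n = detℕ n (λ i j → pf (i + j))

-- b_n = | f⁰_n  αᵗ βᵗ ; α 0 0 ; β 0 0 |  (size n+2)
b : ℕ → ℤ
b n = detℕ (n + 2) M
  where
  M : ℕ → ℕ → ℤ
  M i j = if i <ᵇ n
            then (if j <ᵇ n then pf (i + j) else (if j ≡ᵇ n then α i else β i))
            else (if j <ᵇ n then (if i ≡ᵇ n then α j else β j) else + 0)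

-- c_n = | f⁰_n αᵗ ; α 0 |  (size n+1)
c : ℕ → ℤ
c n = detℕ (n + 1) M
  where
  M : ℕ → ℕ → ℤ
  M i j = if i <ᵇ n
            then (if j <ᵇ n then pf (i + j) else α i)
            else (if j <ᵇ n then α j else + 0)

-- d_n = | f⁰_n βᵗ ; β 0 |  (size n+1)
d : ℕ → ℤ
d n = detℕ (n + 1) M
  where
  M : ℕ → ℕ → ℤ
  M i j = if i <ᵇ n
            then (if j <ᵇ n then pf (i + j) else β i)
            else (if j <ᵇ n then β j else + 0)

-- e_n = | f⁰_n βᵗ ; α 0 |  (size n+1)
e : ℕ → ℤ
e n = detℕ (n + 1) M
  where
  M : ℕ → ℕ → ℤ
  M i j = if i <ᵇ n
            then (if j <ᵇ n then pf (i + j) else β i)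
            else (if j <ᵇ n then α j else + 0)

-- g_n = | f⁰_{n+1,n}  αᵗ(n+1) |  (size n+1)
g : ℕ → ℤ
g n = detℕ (n + 1) (λ i j → if j <ᵇ n then pf (i + j) else α i)

-- h_n = | f⁰_{n+1,n}  βᵗ(n+1) |  (size n+1)
h : ℕ → ℤ
h n = detℕ (n + 1) (λ i j → if j <ᵇ n then pf (i + j) else β i)

-- x_n = | f⁰_{n+1,n} αᵗ(n+1) βᵗ(n+1) ; α(n) 0 0 |  (size n+2)
x : ℕ → ℤ
x n = detℕ (n + 2) M
  where
  M : ℕ → ℕ → ℤ
  M i j = if i <ᵇ n + 1
            then (if j <ᵇ n then pf (i + j) else (if j ≡ᵇ n then α i else β i))
            else (if j <ᵇ n then α j else + 0)

-- y_n = | f⁰_{n+1,n} αᵗ(n+1) βᵗ(n+1) ; β(n) 0 0 |  (size n+2)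
y : ℕ → ℤ
y n = detℕ (n + 2) M
  where
  M : ℕ → ℕ → ℤ
  M i j = if i <ᵇ n + 1
            then (if j <ᵇ n then pf (i + j) else (if j ≡ᵇ n then α i else β i))
            else (if j <ᵇ n then β j else + 0)

ind10 : List ℕ → ℕ → ℕ
ind10 rs n = if any (λ r → r ≡ᵇ (n % 10)) rs then 1 else 0

module Submission where

-- Everything is reduced modulo 2: the parity of an integer determinant is
-- the 𝔽₂-determinant of the entrywise parities.  All nine determinants are
-- instances of one family Δ r s U V: the r × s Hankel block f(i+j),
-- bordered by the columns U and rows V, each α = (1,0,1,0,…) or β.
--
-- The key fact is a halving recursion for Δ.  Split α = ρ₀ + ρ₂ and
-- β = ρ₁ + ρ₃ into residue classes mod 4 and expand multilinearly; write
-- f(i+j) ≡ [i+j odd]·f(⌊i/2⌋+⌊j/2⌋) + (a rank-four matrix coming from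
-- f(4n) = 1, f(4n+2) = 0) and expand the rank-one terms by bordering.  The
-- remaining kernel vanishes when i+j is even, so after sorting rows and
-- columns by parity it is block diagonal, and both blocks are again Δ's of
-- half the size.  Δ depends only on the sets U, V (repeated borders give 0),
-- so only finitely many border configurations occur; a finite computation
-- over the residues mod 10 shows that the claimed table is preserved by the
-- recursion, and strong induction on n finishes the proof.

open import Defs
open import Data.Nat using (ℕ; _≤_; _+_; _%_)
open import Data.Integer using (∣_∣)
open import Data.List using (_∷_; [])
open import Data.Product using (_×_)
open import Relation.Binary.PropositionalEquality using (_≡_)

module Det₂ where

  open import Algebra.Bundles using (CommutativeRing)
  open import Data.Bool using (Bool; true; false; _∧_; _xor_)
  open import Data.Bool.Properties
    using (∧-assoc; ∧-comm; ∧-zeroʳ; ∧-distribˡ-xor; ∧-distribʳ-xor;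
           xor-assoc; xor-comm; xor-same; xor-identityʳ; xor-∧-commutativeRing)
  open import Data.List using (List; []; _∷_; _++_; map; length; [_])
  open import Data.List.Properties using (++-identityʳ)
  open import Data.List.Relation.Unary.All using (All; []; _∷_)
  open import Data.List.Relation.Binary.Permutation.Propositional as Perm using (_↭_)
  open import Data.List.Relation.Binary.Permutation.Propositional.Properties using (shift; ++-comm)
  open import Data.Nat using (suc)
  open import Data.Product using (_×_; _,_; proj₁; proj₂)
  open import Function using (flip)
  open import Relation.Binary.PropositionalEquality hiding ([_])
  open import Relation.Nullary using (¬_; contradiction)
  import Algebra.Properties.CommutativeSemigroup as CommSemigroupProperties

  xor-interchange : ∀ a b c d → (a xor b) xor (c xor d) ≡ (a xor c) xor (b xor d)
  xor-interchange = CommSemigroupProperties.interchange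
    (CommutativeRing.+-commutativeSemigroup xor-∧-commutativeRing)

  ∧-swapˡ : ∀ a b c → a ∧ (b ∧ c) ≡ b ∧ (a ∧ c)
  ∧-swapˡ a b c = begin
    a ∧ (b ∧ c)  ≡⟨ ∧-assoc a b c ⟨
    (a ∧ b) ∧ c  ≡⟨ cong (_∧ c) (∧-comm a b) ⟩
    (b ∧ a) ∧ c  ≡⟨ ∧-assoc b a c ⟩
    b ∧ (a ∧ c)  ∎
    where open ≡-Reasoning

  Σ₂ : ∀ {X : Set} → (X → Bool) → List X → Bool
  Σ₂ f []       = false
  Σ₂ f (x ∷ xs) = f x xor Σ₂ f xs

  module _ {X : Set} where

    Σ₂-cong : ∀ {f g : X → Bool} L → (∀ x → f x ≡ g x) → Σ₂ f L ≡ Σ₂ g L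
    Σ₂-cong []      f≡g = refl
    Σ₂-cong (x ∷ L) f≡g = cong₂ _xor_ (f≡g x) (Σ₂-cong L f≡g)

    Σ₂-congᴬ : ∀ {P : X → Set} {f g : X → Bool} {L} → All P L →
               (∀ x → P x → f x ≡ g x) → Σ₂ f L ≡ Σ₂ g L
    Σ₂-congᴬ []         f≡g = refl
    Σ₂-congᴬ (px ∷ pxs) f≡g = cong₂ _xor_ (f≡g _ px) (Σ₂-congᴬ pxs f≡g)

    Σ₂-zeroᴬ : ∀ {P : X → Set} {f : X → Bool} {L} → All P L →
               (∀ x → P x → f x ≡ false) → Σ₂ f L ≡ false
    Σ₂-zeroᴬ []         f≡0 = refl
    Σ₂-zeroᴬ (px ∷ pxs) f≡0 = cong₂ _xor_ (f≡0 _ px) (Σ₂-zeroᴬ pxs f≡0)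

    Σ₂-zero : ∀ {f : X → Bool} L → (∀ x → f x ≡ false) → Σ₂ f L ≡ false
    Σ₂-zero []      f≡0 = refl
    Σ₂-zero (x ∷ L) f≡0 = cong₂ _xor_ (f≡0 x) (Σ₂-zero L f≡0)

    Σ₂-xor : ∀ (f g : X → Bool) L → Σ₂ (λ x → f x xor g x) L ≡ Σ₂ f L xor Σ₂ g L
    Σ₂-xor f g []      = refl
    Σ₂-xor f g (x ∷ L) =
      trans (cong ((f x xor g x) xor_) (Σ₂-xor f g L)) (xor-interchange (f x) (g x) _ _)

    Σ₂-∧ˡ : ∀ a (f : X → Bool) L → Σ₂ (λ x → a ∧ f x) L ≡ a ∧ Σ₂ f L
    Σ₂-∧ˡ a f []      = sym (∧-zeroʳ a)
    Σ₂-∧ˡ a f (x ∷ L) =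
      trans (cong (a ∧ f x xor_) (Σ₂-∧ˡ a f L)) (sym (∧-distribˡ-xor a (f x) (Σ₂ f L)))

    Σ₂-∧ʳ : ∀ a (f : X → Bool) L → Σ₂ (λ x → f x ∧ a) L ≡ Σ₂ f L ∧ a
    Σ₂-∧ʳ a f L = trans (Σ₂-cong L (λ x → ∧-comm (f x) a))
                        (trans (Σ₂-∧ˡ a f L) (∧-comm a (Σ₂ f L)))

  Σ₂-map : ∀ {X Y : Set} (f : Y → Bool) (g : X → Y) L → Σ₂ f (map g L) ≡ Σ₂ (λ x → f (g x)) L
  Σ₂-map f g []      = refl
  Σ₂-map f g (x ∷ L) = cong (f (g x) xor_) (Σ₂-map f g L)

  Σ₂-swap : ∀ {X Y : Set} (F : X → Y → Bool) L₁ L₂ →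
            Σ₂ (λ x → Σ₂ (F x) L₂) L₁ ≡ Σ₂ (λ y → Σ₂ (λ x → F x y) L₁) L₂
  Σ₂-swap F []       L₂ = sym (Σ₂-zero L₂ (λ _ → refl))
  Σ₂-swap F (x ∷ L₁) L₂ = trans (cong (Σ₂ (F x) L₂ xor_) (Σ₂-swap F L₁ L₂))
                                (sym (Σ₂-xor (F x) (λ y → Σ₂ (λ x → F x y) L₁) L₂))

  picks : ∀ {B : Set} → List B → List (B × List B)
  picks []       = []
  picks (y ∷ ys) = (y , ys) ∷ map (λ p → proj₁ p , y ∷ proj₂ p) (picks ys)

  picks-All : ∀ {B : Set} {P : B → Set} {cs : List B} → All P cs →
              All (λ p → P (proj₁ p) × All P (proj₂ p)) (picks cs)
  picks-All             []         = []
  picks-All {P = P} (py ∷ pys) = (py , pys) ∷ map-All (picks-All pys)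
    where
    map-All : ∀ {L} → All (λ p → P (proj₁ p) × All P (proj₂ p)) L →
              All (λ p → P (proj₁ p) × All P (proj₂ p)) (map (λ p → proj₁ p , _ ∷ proj₂ p) L)
    map-All []              = []
    map-All ((q , qs) ∷ hs) = (q , py ∷ qs) ∷ map-All hs

  picks-length : ∀ {B : Set} (cs : List B) →
                 All (λ p → suc (length (proj₂ p)) ≡ length cs) (picks cs)
  picks-length []       = []
  picks-length (y ∷ ys) = refl ∷ shifted (picks-length ys)
    where
    shifted : ∀ {L} → All (λ p → suc (length (proj₂ p)) ≡ length ys) L →
              All (λ p → suc (length (proj₂ p)) ≡ length (y ∷ ys)) (map (λ p → proj₁ p , y ∷ proj₂ p) L)
    shifted []       = []
    shifted (e ∷ es) = cong suc e ∷ shifted es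

  Σ₂-picks-map : ∀ {B C : Set} (f : B → C) (F : C × List C → Bool) cs →
    Σ₂ F (picks (map f cs)) ≡ Σ₂ (λ p → F (f (proj₁ p) , map f (proj₂ p))) (picks cs)
  Σ₂-picks-map f F []       = refl
  Σ₂-picks-map f F (y ∷ ys) = cong (F (f y , map f ys) xor_)
    (trans (Σ₂-map F _ (picks (map f ys)))
    (trans (Σ₂-picks-map f _ ys)
           (sym (Σ₂-map (λ p → F (f (proj₁ p) , map f (proj₂ p))) _ (picks ys)))))

  Σ₂-picks-++ : ∀ {B : Set} (F : B × List B → Bool) xs ys →
    Σ₂ F (picks (xs ++ ys)) ≡
      Σ₂ (λ p → F (proj₁ p , proj₂ p ++ ys)) (picks xs) xor Σ₂ (λ p → F (proj₁ p , xs ++ proj₂ p)) (picks ys)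
  Σ₂-picks-++ F []       ys = refl
  Σ₂-picks-++ F (x ∷ xs) ys =
    trans (cong (F (x , xs ++ ys) xor_)
            (trans (Σ₂-map F _ (picks (xs ++ ys)))
            (trans (Σ₂-picks-++ _ xs ys)
                   (cong (_xor Σ₂ (λ p → F (proj₁ p , x ∷ xs ++ proj₂ p)) (picks ys))
                         (sym (Σ₂-map (λ p → F (proj₁ p , proj₂ p ++ ys)) _ (picks xs)))))))
          (sym (xor-assoc (F (x , xs ++ ys)) _ _))

  Σ₂-picks-snoc : ∀ {B : Set} (F : B × List B → Bool) xs κ →
    Σ₂ F (picks (xs ++ [ κ ])) ≡ Σ₂ (λ p → F (proj₁ p , proj₂ p ++ [ κ ])) (picks xs) xor F (κ , xs)
  Σ₂-picks-snoc F xs κ =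
    trans (Σ₂-picks-++ F xs [ κ ])
          (cong (Σ₂ (λ p → F (proj₁ p , proj₂ p ++ [ κ ])) (picks xs) xor_)
                (trans (xor-identityʳ _) (cong (λ l → F (κ , l)) (++-identityʳ xs))))

  -- The determinant over 𝔽₂ of the matrix (E x y) whose rows are indexed
  -- by the list rs and columns by the list cs, by Laplace expansion along
  -- the first row (signs are irrelevant in characteristic 2).  Non-square
  -- matrices get determinant 0.
  det₂ : ∀ {A B : Set} → (A → B → Bool) → List A → List B → Bool
  det₂ E []       []      = true
  det₂ E []       (_ ∷ _) = false
  det₂ E (x ∷ rs) cs      = Σ₂ (λ p → E x (proj₁ p) ∧ det₂ E rs (proj₂ p)) (picks cs)

  module _ {A B : Set} where

    det₂-cong : ∀ {E E′ : A → B → Bool} → (∀ x y → E x y ≡ E′ x y) →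
                ∀ rs cs → det₂ E rs cs ≡ det₂ E′ rs cs
    det₂-cong E≡E′ []       []      = refl
    det₂-cong E≡E′ []       (_ ∷ _) = refl
    det₂-cong E≡E′ (x ∷ rs) cs      = Σ₂-cong (picks cs)
      (λ p → cong₂ _∧_ (E≡E′ x (proj₁ p)) (det₂-cong E≡E′ rs (proj₂ p)))

    det₂-congᴬ : ∀ {E E′ : A → B → Bool} {P : A → Set} {Q : B → Set} →
                 (∀ x y → P x → Q y → E x y ≡ E′ x y) →
                 ∀ {rs cs} → All P rs → All Q cs → det₂ E rs cs ≡ det₂ E′ rs cs
    det₂-congᴬ E≡E′ {[]} {[]}    _ _ = refl
    det₂-congᴬ E≡E′ {[]} {_ ∷ _} _ _ = refl
    det₂-congᴬ E≡E′ {x ∷ rs} (px ∷ prs) pcs = Σ₂-congᴬ (picks-All pcs)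
      (λ p q → cong₂ _∧_ (E≡E′ x (proj₁ p) px (proj₁ q)) (det₂-congᴬ E≡E′ prs (proj₂ q)))

    det₂-nonsquare : ∀ (E : A → B → Bool) rs cs → ¬ (length rs ≡ length cs) → det₂ E rs cs ≡ false
    det₂-nonsquare E []       []      ne = contradiction refl ne
    det₂-nonsquare E []       (_ ∷ _) ne = refl
    det₂-nonsquare E (x ∷ rs) cs      ne = Σ₂-zeroᴬ (picks-length cs)
      (λ p e → trans (cong (E x (proj₁ p) ∧_)
                           (det₂-nonsquare E rs (proj₂ p) (λ q → ne (trans (cong suc q) e))))
                     (∧-zeroʳ _))

  det₂-map : ∀ {A B A′ B′ : Set} (E : A′ → B′ → Bool) (φ : A → A′) (ψ : B → B′) rs cs →
             det₂ E (map φ rs) (map ψ cs) ≡ det₂ (λ x y → E (φ x) (ψ y)) rs cs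
  det₂-map E φ ψ []       []      = refl
  det₂-map E φ ψ []       (_ ∷ _) = refl
  det₂-map E φ ψ (x ∷ rs) cs      =
    trans (Σ₂-picks-map ψ (λ p → E (φ x) (proj₁ p) ∧ det₂ E (map φ rs) (proj₂ p)) cs)
          (Σ₂-cong (picks cs) (λ p → cong (E (φ x) (ψ (proj₁ p)) ∧_) (det₂-map E φ ψ rs (proj₂ p))))

  Σ₂-pairs : ∀ {B : Set} → (B → B → List B → Bool) → List B → Bool
  Σ₂-pairs F cs = Σ₂ (λ p → Σ₂ (λ q → F (proj₁ p) (proj₁ q) (proj₂ q)) (picks (proj₂ p))) (picks cs)

  Σ₂-pairs-cong : ∀ {B : Set} {F G : B → B → List B → Bool} cs →
                  (∀ a b r → F a b r ≡ G a b r) → Σ₂-pairs F cs ≡ Σ₂-pairs G cs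
  Σ₂-pairs-cong cs F≡G = Σ₂-cong (picks cs) (λ p → Σ₂-cong (picks (proj₂ p)) (λ q → F≡G _ _ _))

  Σ₂-pairs-∷ : ∀ {B : Set} (F : B → B → List B → Bool) y ys →
    Σ₂-pairs F (y ∷ ys) ≡
      (Σ₂ (λ q → F y (proj₁ q) (proj₂ q)) (picks ys) xor Σ₂ (λ p → F (proj₁ p) y (proj₂ p)) (picks ys))
      xor Σ₂-pairs (λ a b r → F a b (y ∷ r)) ys
  Σ₂-pairs-∷ {B} F y ys =
    trans (cong (Σ₂ (λ q → F y (proj₁ q) (proj₂ q)) (picks ys) xor_)
            (trans (Σ₂-map inner _ (picks ys))
            (trans (Σ₂-cong (picks ys)
                      (λ p → cong (F (proj₁ p) y (proj₂ p) xor_) (Σ₂-map _ _ (picks (proj₂ p)))))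
                   (Σ₂-xor (λ p → F (proj₁ p) y (proj₂ p)) _ (picks ys)))))
          (sym (xor-assoc (Σ₂ (λ q → F y (proj₁ q) (proj₂ q)) (picks ys)) _ _))
    where
    inner : B × List B → Bool
    inner p = Σ₂ (λ q → F (proj₁ p) (proj₁ q) (proj₂ q)) (picks (proj₂ p))

  Σ₂-pairs-flip : ∀ {B : Set} (F : B → B → List B → Bool) cs →
                  Σ₂-pairs F cs ≡ Σ₂-pairs (λ a b r → F b a r) cs
  Σ₂-pairs-flip F []       = refl
  Σ₂-pairs-flip F (y ∷ ys) =
    trans (Σ₂-pairs-∷ F y ys)
    (trans (cong₂ _xor_ (xor-comm (Σ₂ (λ q → F y (proj₁ q) (proj₂ q)) (picks ys)) _) (Σ₂-pairs-flip (λ a b r → F a b (y ∷ r)) ys))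
           (sym (Σ₂-pairs-∷ (λ a b r → F b a r) y ys)))

  -- … so a symmetric summand sums to zero (each pair is counted twice).
  Σ₂-pairs-symmetric : ∀ {B : Set} (F : B → B → List B → Bool) cs →
                       (∀ a b r → F a b r ≡ F b a r) → Σ₂-pairs F cs ≡ false
  Σ₂-pairs-symmetric F []       sym-F = refl
  Σ₂-pairs-symmetric F (y ∷ ys) sym-F =
    trans (Σ₂-pairs-∷ F y ys)
          (cong₂ _xor_
            (trans (cong (Σ₂ (λ q → F y (proj₁ q) (proj₂ q)) (picks ys) xor_)
                         (Σ₂-cong (picks ys) (λ p → sym-F (proj₁ p) y (proj₂ p))))
                   (xor-same (Σ₂ (λ q → F y (proj₁ q) (proj₂ q)) (picks ys))))
            (Σ₂-pairs-symmetric (λ a b r → F a b (y ∷ r)) ys (λ a b r → sym-F a b (y ∷ r))))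

  module _ {A B : Set} where

    det₂-two-rows : ∀ (E : A → B → Bool) x y rs cs →
      det₂ E (x ∷ y ∷ rs) cs ≡ Σ₂-pairs (λ a b r → E x a ∧ (E y b ∧ det₂ E rs r)) cs
    det₂-two-rows E x y rs cs =
      Σ₂-cong (picks cs) (λ p → sym (Σ₂-∧ˡ (E x (proj₁ p)) _ (picks (proj₂ p))))

    det₂-swap : ∀ (E : A → B → Bool) x y rs cs → det₂ E (x ∷ y ∷ rs) cs ≡ det₂ E (y ∷ x ∷ rs) cs
    det₂-swap E x y rs cs =
      trans (det₂-two-rows E x y rs cs)
      (trans (Σ₂-pairs-flip _ cs)
      (trans (Σ₂-pairs-cong cs (λ a b r → ∧-swapˡ (E x b) (E y a) _))
             (sym (det₂-two-rows E y x rs cs))))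

    det₂-∷ : ∀ (E : A → B → Bool) x {xs ys} → (∀ cs → det₂ E xs cs ≡ det₂ E ys cs) →
             ∀ cs → det₂ E (x ∷ xs) cs ≡ det₂ E (x ∷ ys) cs
    det₂-∷ E x xs≈ys cs = Σ₂-cong (picks cs) (λ p → cong (E x (proj₁ p) ∧_) (xs≈ys (proj₂ p)))

    det₂-perm : ∀ (E : A → B → Bool) {xs ys} → xs ↭ ys → ∀ cs → det₂ E xs cs ≡ det₂ E ys cs
    det₂-perm E Perm.refl cs = refl
    det₂-perm E {x ∷ xs} {_ ∷ ys} (Perm.prep _ p) cs = det₂-∷ E x {xs} {ys} (det₂-perm E p) cs
    det₂-perm E {x ∷ y ∷ xs} {_ ∷ _ ∷ ys} (Perm.swap _ _ p) cs =
      trans (det₂-∷ E x {y ∷ xs} {y ∷ ys} (det₂-∷ E y {xs} {ys} (det₂-perm E p)) cs)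
            (det₂-swap E x y ys cs)
    det₂-perm E (Perm.trans p q)   cs = trans (det₂-perm E p cs) (det₂-perm E q cs)

    det₂-equal-rows : ∀ (E : A → B → Bool) x y → (∀ c → E x c ≡ E y c) →
                      ∀ rs cs → det₂ E (x ∷ y ∷ rs) cs ≡ false
    det₂-equal-rows E x y x≈y rs cs =
      trans (det₂-two-rows E x y rs cs)
      (trans (Σ₂-pairs-cong cs (λ a b r → cong (λ z → E x a ∧ (z ∧ det₂ E rs r)) (sym (x≈y b))))
             (Σ₂-pairs-symmetric _ cs (λ a b r → ∧-swapˡ (E x a) (E x b) _)))

    det₂-column-expansion : ∀ (E : A → B → Bool) rs c cs →
      det₂ E rs (c ∷ cs) ≡ Σ₂ (λ q → E (proj₁ q) c ∧ det₂ E (proj₂ q) cs) (picks rs)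
    det₂-column-expansion E []       c cs = refl
    det₂-column-expansion E (r ∷ rs) c cs =
      cong (E r c ∧ det₂ E rs cs xor_)
        (trans (Σ₂-map _ _ (picks cs))
        (trans (Σ₂-cong (picks cs) (λ p →
                  trans (cong (E r (proj₁ p) ∧_) (det₂-column-expansion E rs c (proj₂ p)))
                        (sym (Σ₂-∧ˡ (E r (proj₁ p)) _ (picks rs)))))
        (trans (Σ₂-swap (λ p q → E r (proj₁ p) ∧ (E (proj₁ q) c ∧ det₂ E (proj₂ q) (proj₂ p)))
                        (picks cs) (picks rs))
        (trans (Σ₂-cong (picks rs) (λ q →
                  trans (Σ₂-cong (picks cs) (λ p → ∧-swapˡ (E r (proj₁ p)) (E (proj₁ q) c) _))
                        (Σ₂-∧ˡ (E (proj₁ q) c) _ (picks cs))))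
               (sym (Σ₂-map _ _ (picks rs)))))))

  det₂-transpose : ∀ {A B : Set} (E : A → B → Bool) rs cs → det₂ E rs cs ≡ det₂ (flip E) cs rs
  det₂-transpose E []       []       = refl
  det₂-transpose E (x ∷ rs) []       = refl
  det₂-transpose E []       (c ∷ cs) = refl
  det₂-transpose E (x ∷ rs) (c ∷ cs) =
    trans (det₂-column-expansion E (x ∷ rs) c cs)
          (Σ₂-cong (picks (x ∷ rs)) (λ q → cong (E (proj₁ q) c ∧_) (det₂-transpose E (proj₂ q) cs)))

  module _ {A B : Set} where

    det₂-column-perm : ∀ (E : A → B → Bool) rs {cs cs′} → cs ↭ cs′ → det₂ E rs cs ≡ det₂ E rs cs′
    det₂-column-perm E rs {cs} {cs′} p =
      trans (det₂-transpose E rs cs) (trans (det₂-perm (flip E) p rs) (sym (det₂-transpose E rs cs′)))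

    det₂-equal-columns : ∀ (E : A → B → Bool) y y′ → (∀ r → E r y ≡ E r y′) →
                         ∀ rs cs → det₂ E rs (y ∷ y′ ∷ cs) ≡ false
    det₂-equal-columns E y y′ y≈y′ rs cs =
      trans (det₂-transpose E rs (y ∷ y′ ∷ cs)) (det₂-equal-rows (flip E) y y′ y≈y′ cs rs)

    det₂-linear : ∀ (E : A → B → Bool) z (Z : List A) → (∀ c → E z c ≡ Σ₂ (λ w → E w c) Z) →
                  ∀ R₁ R₂ cs → det₂ E (R₁ ++ z ∷ R₂) cs ≡ Σ₂ (λ w → det₂ E (R₁ ++ w ∷ R₂) cs) Z
    det₂-linear E z Z z≡ΣZ R₁ R₂ cs =
      trans (det₂-perm E (shift z R₁ R₂) cs)
      (trans (Σ₂-cong (picks cs) (λ p →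
                trans (cong (_∧ det₂ E (R₁ ++ R₂) (proj₂ p)) (z≡ΣZ (proj₁ p)))
                      (sym (Σ₂-∧ʳ (det₂ E (R₁ ++ R₂) (proj₂ p)) (λ w → E w (proj₁ p)) Z))))
      (trans (Σ₂-swap (λ p w → E w (proj₁ p) ∧ det₂ E (R₁ ++ R₂) (proj₂ p)) (picks cs) Z)
             (Σ₂-cong Z (λ w → sym (det₂-perm E (shift w R₁ R₂) cs)))))

  det₂-linear-column : ∀ {A B : Set} (E : A → B → Bool) z (Z : List B) →
    (∀ r → E r z ≡ Σ₂ (λ w → E r w) Z) →
    ∀ rs C₁ C₂ → det₂ E rs (C₁ ++ z ∷ C₂) ≡ Σ₂ (λ w → det₂ E rs (C₁ ++ w ∷ C₂)) Z
  det₂-linear-column E z Z z≡ΣZ rs C₁ C₂ =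
    trans (det₂-transpose E rs (C₁ ++ z ∷ C₂))
    (trans (det₂-linear (flip E) z Z z≡ΣZ C₁ C₂ rs)
           (Σ₂-cong Z (λ w → sym (det₂-transpose E rs (C₁ ++ w ∷ C₂)))))

  -- Rank-one update (matrix determinant lemma, bordered form): adding the
  -- rank-one matrix (E x κ · E ρ y) changes the determinant by the
  -- determinant bordered with the extra row ρ and extra column κ,
  -- provided the corner entry E ρ κ vanishes.
  module RankOne {A B : Set} (E : A → B → Bool) (ρ : A) (κ : B) (corner : E ρ κ ≡ false) where

    E⁺ : A → B → Bool
    E⁺ x y = E x y xor (E x κ ∧ E ρ y)

    private
      ρ-to-front : ∀ (rs : List A) → (rs ++ [ ρ ]) ↭ (ρ ∷ rs)
      ρ-to-front rs = ++-comm rs [ ρ ]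

      snoc-nonempty : ∀ (cs : List B) → ¬ (length (ρ ∷ []) ≡ length (κ ∷ cs ++ [ κ ]))
      snoc-nonempty []      ()
      snoc-nonempty (_ ∷ _) ()

      distribute : ∀ a k b c d → (a xor (k ∧ b)) ∧ (c xor d) ≡ (a ∧ c) xor ((a ∧ d) xor (k ∧ (b ∧ (c xor d))))
      distribute a k b c d = begin
        (a xor (k ∧ b)) ∧ (c xor d)                ≡⟨ ∧-distribʳ-xor (c xor d) a (k ∧ b) ⟩
        (a ∧ (c xor d)) xor ((k ∧ b) ∧ (c xor d))  ≡⟨ cong₂ _xor_ (∧-distribˡ-xor a c d) (∧-assoc k b _) ⟩
        ((a ∧ c) xor (a ∧ d)) xor (k ∧ (b ∧ (c xor d)))  ≡⟨ xor-assoc (a ∧ c) (a ∧ d) _ ⟩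
        (a ∧ c) xor ((a ∧ d) xor (k ∧ (b ∧ (c xor d))))  ∎
        where open ≡-Reasoning

      border-row : ∀ rs cs → det₂ E (rs ++ [ ρ ]) cs ≡
        Σ₂ (λ p → E ρ (proj₁ p) ∧ (det₂ E rs (proj₂ p) xor det₂ E (rs ++ [ ρ ]) (proj₂ p ++ [ κ ])))
           (picks cs)
      border-row rs cs = sym (
        trans (Σ₂-cong (picks cs) (λ p → ∧-distribˡ-xor (E ρ (proj₁ p)) _ _))
        (trans (Σ₂-xor _ _ (picks cs))
        (trans (cong₂ _xor_ (sym (det₂-perm E (ρ-to-front rs) cs)) ρ-twice)
               (xor-identityʳ _))))
        where
        -- These terms form the expansion of a determinant in which ρ occurs twice.
        ρ-twice : Σ₂ (λ p → E ρ (proj₁ p) ∧ det₂ E (rs ++ [ ρ ]) (proj₂ p ++ [ κ ])) (picks cs) ≡ false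
        ρ-twice = trans (sym (xor-identityʳ _))
          (trans (cong (Σ₂ (λ p → E ρ (proj₁ p) ∧ det₂ E (rs ++ [ ρ ]) (proj₂ p ++ [ κ ])) (picks cs) xor_)
                       (sym (cong (_∧ det₂ E (rs ++ [ ρ ]) cs) corner)))
          (trans (sym (Σ₂-picks-snoc (λ p → E ρ (proj₁ p) ∧ det₂ E (rs ++ [ ρ ]) (proj₂ p)) cs κ))
          (trans (det₂-perm E (Perm.prep ρ (ρ-to-front rs)) (cs ++ [ κ ]))
                 (det₂-equal-rows E ρ ρ (λ _ → refl) rs (cs ++ [ κ ])))))

    rank-one : ∀ rs cs → det₂ E⁺ rs cs ≡ det₂ E rs cs xor det₂ E (rs ++ [ ρ ]) (cs ++ [ κ ])
    rank-one []       []       rewrite corner = refl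
    rank-one []       (c ∷ cs) = sym (det₂-nonsquare E [ ρ ] (c ∷ cs ++ [ κ ]) (snoc-nonempty cs))
    rank-one (x ∷ rs) cs =
      trans (Σ₂-cong (picks cs) (λ p → trans (cong (E⁺ x (proj₁ p) ∧_) (rank-one rs (proj₂ p)))
                                            (distribute (E x (proj₁ p)) (E x κ) (E ρ (proj₁ p)) _ _)))
      (trans (Σ₂-xor _ _ (picks cs))
      (cong (det₂ E (x ∷ rs) cs xor_)
        (trans (Σ₂-xor _ _ (picks cs))
        (trans (cong (Σ₂ (λ p → E x (proj₁ p) ∧ det₂ E (rs ++ [ ρ ]) (proj₂ p ++ [ κ ])) (picks cs) xor_)
                     (trans (Σ₂-∧ˡ (E x κ) _ (picks cs)) (cong (E x κ ∧_) (sym (border-row rs cs)))))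
               (sym (Σ₂-picks-snoc (λ p → E x (proj₁ p) ∧ det₂ E (rs ++ [ ρ ]) (proj₂ p)) cs κ))))))

  module BlockDiagonal {A B : Set} (E : A → B → Bool) (P P′ : A → Set) (Q Q′ : B → Set)
     (zero-PQ′ : ∀ x y → P x → Q′ y → E x y ≡ false)
     (zero-P′Q : ∀ x y → P′ x → Q y → E x y ≡ false) where

    block-diagonal : ∀ {rs rs′ cs cs′} → All P rs → All P′ rs′ → All Q cs → All Q′ cs′ →
                     det₂ E (rs ++ rs′) (cs ++ cs′) ≡ det₂ E rs cs ∧ det₂ E rs′ cs′
    block-diagonal {[]} {rs′} {[]}     _ _  _        _ = refl
    block-diagonal {[]} {rs′} {y ∷ cs} {cs′} _ p′ (qy ∷ _) _ =
      trans (det₂-column-expansion E rs′ y (cs ++ cs′))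
            (Σ₂-zeroᴬ (picks-All p′)
              (λ q h → cong (_∧ det₂ E (proj₂ q) (cs ++ cs′)) (zero-P′Q _ y (proj₁ h) qy)))
    block-diagonal {x ∷ rs} {rs′} {cs} {cs′} (px ∷ ps) p′ qs q′ =
      trans (Σ₂-picks-++ _ cs cs′)
      (trans (cong₂ _xor_
                (Σ₂-congᴬ (picks-All qs)
                  (λ p h → cong (E x (proj₁ p) ∧_) (block-diagonal ps p′ (proj₂ h) q′)))
                (Σ₂-zeroᴬ (picks-All q′)
                  (λ p h → cong (_∧ det₂ E (rs ++ rs′) (cs ++ proj₂ p)) (zero-PQ′ x _ px (proj₁ h)))))
      (trans (xor-identityʳ _)
      (trans (Σ₂-cong (picks cs) (λ p → sym (∧-assoc (E x (proj₁ p)) _ _)))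
             (Σ₂-∧ʳ (det₂ E rs′ cs′) _ (picks cs)))))

module BorderedHankel where

  open Det₂

  open import Data.Bool using (Bool; true; false; _∧_; _xor_; not; if_then_else_)
  open import Data.Bool.Properties using (∧-zeroʳ; xor-identityʳ)
  open import Data.List using (List; []; _∷_; _++_; map; [_])
  open import Data.List.Properties using (++-assoc; ++-identityʳ; map-++)
  open import Data.List.Relation.Unary.All using (All; []; _∷_)
  import Data.List.Relation.Unary.All.Properties as All
  open import Data.List.Relation.Binary.Permutation.Propositional as Perm using (_↭_)
  open import Data.List.Relation.Binary.Permutation.Propositional.Properties
    using (shift; ++-comm; ++⁺; ++⁺ˡ; ++⁺ʳ; map⁺)
  open import Data.Nat using (ℕ; zero; suc; _+_; ⌊_/2⌋; ⌈_/2⌉; parity)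
  open import Data.Parity.Base using (Parity; 0ℙ; 1ℙ)
  import Data.Parity.Properties as ℙ
  open import Data.Nat.Properties using (+-suc; n≡⌊n+n/2⌋)
  open import Data.Product using (_×_; _,_)
  open import Function using (_∘_)
  open import Relation.Binary.PropositionalEquality hiding ([_])

  isEven : Parity → Bool
  isEven 0ℙ = true
  isEven 1ℙ = false

  even : ℕ → Bool
  even n = isEven (parity n)

  double : ℕ → ℕ
  double p = p + p

  data ParityView : ℕ → Set where
    even-view : ∀ p → ParityView (p + p)
    odd-view  : ∀ p → ParityView (suc (p + p))

  parityView : ∀ n → ParityView n
  parityView zero = even-view zero
  parityView (suc n) with parityView n
  ... | even-view p = odd-view p
  ... | odd-view p rewrite sym (+-suc p p) = even-view (suc p)

  even-double : ∀ p → even (p + p) ≡ true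
  even-double zero    = refl
  even-double (suc p) rewrite +-suc p p = even-double p

  even-suc-double : ∀ p → even (suc (p + p)) ≡ false
  even-suc-double zero    = refl
  even-suc-double (suc p) rewrite +-suc p p = even-suc-double p

  even-suc : ∀ n → even (suc n) ≡ not (even n)
  even-suc zero          = refl
  even-suc (suc zero)    = refl
  even-suc (suc (suc n)) = even-suc n

  even-+ : ∀ a b → even (a + b) ≡ (if even a then even b else not (even b))
  even-+ a b rewrite ℙ.+-homo-+ a b with parity a | parity b
  ... | 0ℙ | _  = refl
  ... | 1ℙ | 0ℙ = refl
  ... | 1ℙ | 1ℙ = refl

  ⌊double/2⌋ : ∀ p → ⌊ p + p /2⌋ ≡ p
  ⌊double/2⌋ p = sym (n≡⌊n+n/2⌋ p)

  ⌊suc-double/2⌋ : ∀ p → ⌊ suc (p + p) /2⌋ ≡ p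
  ⌊suc-double/2⌋ zero    = refl
  ⌊suc-double/2⌋ (suc p) rewrite +-suc p p = cong suc (⌊suc-double/2⌋ p)

  -- The border vectors α = (1,0,1,0,…) and β = (0,1,0,1,…), and their
  -- restrictions to the residue classes modulo 4 (α = ρ₀ + ρ₂, β = ρ₁ + ρ₃).
  data Border : Set where
    αb βb : Border

  data Residue : Set where
    ρ₀ ρ₁ ρ₂ ρ₃ : Residue

  data Code : Set where
    whole : Border → Code
    part  : Residue → Code

  value : Code → ℕ → Bool
  value (whole αb) i = even i
  value (whole βb) i = not (even i)
  value (part ρ₀)  i = even i ∧ even ⌊ i /2⌋
  value (part ρ₁)  i = not (even i) ∧ even ⌊ i /2⌋
  value (part ρ₂)  i = even i ∧ not (even ⌊ i /2⌋)
  value (part ρ₃)  i = not (even i) ∧ not (even ⌊ i /2⌋)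

  residues : Border → List Residue
  residues αb = ρ₀ ∷ ρ₂ ∷ []
  residues βb = ρ₁ ∷ ρ₃ ∷ []

  -- ρₖ lives on indices of parity k; after halving the index it becomes α
  -- (k = 0, 1) or β (k = 2, 3).
  odd-residue : Residue → Bool
  odd-residue ρ₁ = true
  odd-residue ρ₃ = true
  odd-residue _  = false

  even-residue : Residue → Bool
  even-residue k = not (odd-residue k)

  lower : Residue → Border
  lower ρ₀ = αb
  lower ρ₁ = αb
  lower ρ₂ = βb
  lower ρ₃ = βb

  private
    exactly-one : ∀ e → true ≡ (e xor ((not e) xor false))
    exactly-one true  = refl
    exactly-one false = refl

  value-residues : ∀ b i → value (whole b) i ≡ Σ₂ (λ k → value (part k) i) (residues b)
  value-residues αb i with parityView i
  ... | even-view p rewrite even-double p | ⌊double/2⌋ p = exactly-one (even p)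
  ... | odd-view p rewrite even-suc-double p = refl
  value-residues βb i with parityView i
  ... | even-view p rewrite even-double p = refl
  ... | odd-view p rewrite even-suc-double p | ⌊suc-double/2⌋ p = exactly-one (even p)

  data Label : Set where
    idx : ℕ → Label
    vec : Code → Label

  border : Border → Label
  border = vec ∘ whole

  residue : Residue → Label
  residue = vec ∘ part

  bordered : (ℕ → ℕ → Bool) → Label → Label → Bool
  bordered K (idx i) (idx j) = K i j
  bordered K (idx i) (vec w) = value w i
  bordered K (vec w) (idx j) = value w j
  bordered K (vec _) (vec _) = false

  Σ-refinements : (List Residue → Bool) → List Border → Bool
  Σ-refinements F []      = F []
  Σ-refinements F (b ∷ U) = Σ₂ (λ k → Σ-refinements (λ W → F (k ∷ W)) U) (residues b)

  Σ-refinements-cong : ∀ {F G : List Residue → Bool} U → (∀ W → F W ≡ G W) →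
                       Σ-refinements F U ≡ Σ-refinements G U
  Σ-refinements-cong []      F≡G = F≡G []
  Σ-refinements-cong (b ∷ U) F≡G =
    Σ₂-cong (residues b) (λ k → Σ-refinements-cong U (λ W → F≡G (k ∷ W)))

  module Refine (K : ℕ → ℕ → Bool) where

    private
      column-sum : ∀ b r → bordered K r (border b) ≡ Σ₂ (bordered K r) (map residue (residues b))
      column-sum b (idx i) = trans (value-residues b i) (sym (Σ₂-map _ residue (residues b)))
      column-sum αb (vec _) = refl
      column-sum βb (vec _) = refl

      row-sum : ∀ b c → bordered K (border b) c ≡ Σ₂ (λ x → bordered K x c) (map residue (residues b))
      row-sum b (idx j) = trans (value-residues b j) (sym (Σ₂-map _ residue (residues b)))
      row-sum αb (vec _) = refl
      row-sum βb (vec _) = refl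

    refine-columns : ∀ U rs C → det₂ (bordered K) rs (C ++ map border U) ≡
                     Σ-refinements (λ W → det₂ (bordered K) rs (C ++ map residue W)) U
    refine-columns []      rs C = refl
    refine-columns (b ∷ U) rs C =
      trans (det₂-linear-column (bordered K) (border b) (map residue (residues b)) (λ r → column-sum b r) rs C (map border U))
      (trans (Σ₂-map _ residue (residues b))
      (Σ₂-cong (residues b) (λ k →
         trans (cong (det₂ (bordered K) rs) (sym (++-assoc C [ residue k ] (map border U))))
         (trans (refine-columns U rs (C ++ [ residue k ]))
         (Σ-refinements-cong U (λ W → cong (det₂ (bordered K) rs) (++-assoc C [ residue k ] (map residue W))))))))

    refine-rows : ∀ V cs R → det₂ (bordered K) (R ++ map border V) cs ≡
                  Σ-refinements (λ W → det₂ (bordered K) (R ++ map residue W) cs) V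
    refine-rows []      cs R = refl
    refine-rows (b ∷ V) cs R =
      trans (det₂-linear (bordered K) (border b) (map residue (residues b)) (λ c → row-sum b c) R (map border V) cs)
      (trans (Σ₂-map _ residue (residues b))
      (Σ₂-cong (residues b) (λ k →
         trans (cong (λ l → det₂ (bordered K) l cs) (sym (++-assoc R [ residue k ] (map border V))))
         (trans (refine-rows V cs (R ++ [ residue k ]))
         (Σ-refinements-cong V (λ W → cong (λ l → det₂ (bordered K) l cs) (++-assoc R [ residue k ] (map residue W))))))))

  add-rank-ones : List (Residue × Residue) → (ℕ → ℕ → Bool) → ℕ → ℕ → Bool
  add-rank-ones []            K i j = K i j
  add-rank-ones ((a , b) ∷ T) K i j = add-rank-ones T K i j xor (value (part a) i ∧ value (part b) j)

  Σ-borderings : (List Residue → List Residue → Bool) → List (Residue × Residue) → Bool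
  Σ-borderings F []            = F [] []
  Σ-borderings F ((a , b) ∷ T) = Σ-borderings F T xor Σ-borderings (λ Cs Rs → F (a ∷ Cs) (b ∷ Rs)) T

  Σ-borderings-cong : ∀ {F G : List Residue → List Residue → Bool} T →
                      (∀ Cs Rs → F Cs Rs ≡ G Cs Rs) → Σ-borderings F T ≡ Σ-borderings G T
  Σ-borderings-cong []            F≡G = F≡G [] []
  Σ-borderings-cong ((a , b) ∷ T) F≡G =
    cong₂ _xor_ (Σ-borderings-cong T F≡G) (Σ-borderings-cong T (λ Cs Rs → F≡G (a ∷ Cs) (b ∷ Rs)))

  rank-ones-expansion : ∀ T K R C → det₂ (bordered (add-rank-ones T K)) R C ≡
    Σ-borderings (λ Cs Rs → det₂ (bordered K) (R ++ map residue Rs) (C ++ map residue Cs)) T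
  rank-ones-expansion [] K R C = sym (cong₂ (det₂ (bordered K)) (++-identityʳ R) (++-identityʳ C))
  rank-ones-expansion ((a , b) ∷ T) K R C =
    trans (det₂-cong agree R C)
    (trans (RankOne.rank-one E (residue b) (residue a) refl R C)
    (cong₂ _xor_ (rank-ones-expansion T K R C)
       (trans (rank-ones-expansion T K (R ++ [ residue b ]) (C ++ [ residue a ]))
              (Σ-borderings-cong T (λ Cs Rs →
                 cong₂ (det₂ (bordered K)) (++-assoc R [ residue b ] (map residue Rs))
                                           (++-assoc C [ residue a ] (map residue Cs)))))))
    where
    E = bordered (add-rank-ones T K)
    agree : ∀ x y → bordered (add-rank-ones ((a , b) ∷ T) K) x y ≡ RankOne.E⁺ E (residue b) (residue a) refl x y
    agree (idx i) (idx j) = refl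
    agree (idx i) (vec w) = sym (trans (cong (value w i xor_) (∧-zeroʳ (value (part a) i))) (xor-identityʳ _))
    agree (vec w) (idx j) = sym (xor-identityʳ _)
    agree (vec w) (vec _) = refl

  range : ℕ → List ℕ
  range zero    = []
  range (suc n) = range n ++ [ n ]

  evens odds : ℕ → List ℕ
  evens r = map double (range ⌈ r /2⌉)
  odds  r = map (suc ∘ double) (range ⌊ r /2⌋)

  private
    map-snoc : ∀ {X Y : Set} (f : X → Y) l x → map f (l ++ [ x ]) ≡ map f l ++ [ f x ]
    map-snoc f l x = map-++ f l [ x ]

    ↭-middle : ∀ {X : Set} (a b c d : List X) → (a ++ b) ++ (c ++ d) ↭ (a ++ c) ++ (b ++ d)
    ↭-middle a b c d =
      Perm.↭-trans (Perm.↭-reflexive (++-assoc a b (c ++ d)))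
      (Perm.↭-trans (++⁺ˡ a (Perm.↭-trans (Perm.↭-reflexive (sym (++-assoc b c d)))
                             (Perm.↭-trans (++⁺ʳ d (++-comm b c)) (Perm.↭-reflexive (++-assoc c b d)))))
                    (Perm.↭-reflexive (sym (++-assoc a c (b ++ d)))))

    next-pair : ∀ r → (r ∷ suc r ∷ []) ↭ (double ⌈ r /2⌉ ∷ suc (double ⌊ r /2⌋) ∷ [])
    next-pair r with parityView r
    ... | even-view p rewrite ⌊suc-double/2⌋ p | ⌊double/2⌋ p = Perm.refl
    ... | odd-view  p rewrite ⌊double/2⌋ p | ⌊suc-double/2⌋ p | +-suc p p = Perm.swap _ _ Perm.refl

  range-by-parity : ∀ r → range r ↭ evens r ++ odds r
  range-by-parity zero          = Perm.refl
  range-by-parity (suc zero)    = Perm.refl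
  range-by-parity (suc (suc r))
    rewrite map-snoc double (range ⌈ r /2⌉) ⌈ r /2⌉ | map-snoc (suc ∘ double) (range ⌊ r /2⌋) ⌊ r /2⌋ =
    Perm.↭-trans (Perm.↭-reflexive (++-assoc (range r) [ r ] [ suc r ]))
    (Perm.↭-trans (++⁺ (range-by-parity r) (next-pair r))
                  (↭-middle (evens r) (odds r) [ double ⌈ r /2⌉ ] [ suc (double ⌊ r /2⌋) ]))

  keep : (Residue → Bool) → List Residue → List Residue
  keep f []      = []
  keep f (k ∷ W) = if f k then k ∷ keep f W else keep f W

  keep-↭ : ∀ W → W ↭ keep odd-residue W ++ keep even-residue W
  keep-↭ []      = Perm.refl
  keep-↭ (k ∷ W) with odd-residue k
  ... | true  = Perm.prep k (keep-↭ W)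
  ... | false = Perm.↭-trans (Perm.prep k (keep-↭ W)) (Perm.↭-sym (shift k (keep odd-residue W) _))

  -- The two halves of the parity decomposition: labels that only meet
  -- odd indices (even indices, ρ₁, ρ₃) and labels that only meet even
  -- indices (odd indices, ρ₀, ρ₂).
  data EvenSide : Label → Set where
    even-idx : ∀ p → EvenSide (idx (p + p))
    ρ₁-side  : EvenSide (residue ρ₁)
    ρ₃-side  : EvenSide (residue ρ₃)

  data OddSide : Label → Set where
    odd-idx : ∀ p → OddSide (idx (suc (p + p)))
    ρ₀-side : OddSide (residue ρ₀)
    ρ₂-side : OddSide (residue ρ₂)

  halve : Label → Label
  halve (idx i)          = idx ⌊ i /2⌋
  halve (vec (whole b))  = border b
  halve (vec (part k))   = border (lower k)

  private
    evens-side : ∀ L → All EvenSide (map idx (map double L))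
    evens-side []      = []
    evens-side (p ∷ L) = even-idx p ∷ evens-side L

    odds-side : ∀ L → All OddSide (map idx (map (suc ∘ double) L))
    odds-side []      = []
    odds-side (p ∷ L) = odd-idx p ∷ odds-side L

    kept-odd-side : ∀ W → All EvenSide (map residue (keep odd-residue W))
    kept-odd-side []       = []
    kept-odd-side (ρ₀ ∷ W) = kept-odd-side W
    kept-odd-side (ρ₁ ∷ W) = ρ₁-side ∷ kept-odd-side W
    kept-odd-side (ρ₂ ∷ W) = kept-odd-side W
    kept-odd-side (ρ₃ ∷ W) = ρ₃-side ∷ kept-odd-side W

    kept-even-side : ∀ W → All OddSide (map residue (keep even-residue W))
    kept-even-side []       = []
    kept-even-side (ρ₀ ∷ W) = ρ₀-side ∷ kept-even-side W
    kept-even-side (ρ₁ ∷ W) = kept-even-side W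
    kept-even-side (ρ₂ ∷ W) = ρ₂-side ∷ kept-even-side W
    kept-even-side (ρ₃ ∷ W) = kept-even-side W

    halve-evens : ∀ L → map halve (map idx (map double L)) ≡ map idx L
    halve-evens []      = refl
    halve-evens (p ∷ L) = cong₂ _∷_ (cong idx (⌊double/2⌋ p)) (halve-evens L)

    halve-odds : ∀ L → map halve (map idx (map (suc ∘ double) L)) ≡ map idx L
    halve-odds []      = refl
    halve-odds (p ∷ L) = cong₂ _∷_ (cong idx (⌊suc-double/2⌋ p)) (halve-odds L)

    halve-residues : ∀ W → map halve (map residue W) ≡ map border (map lower W)
    halve-residues []      = refl
    halve-residues (k ∷ W) = cong (_ ∷_) (halve-residues W)

  even-labels odd-labels : ℕ → List Residue → List Label
  even-labels n Y = map idx (evens n) ++ map residue (keep odd-residue Y)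
  odd-labels  n Y = map idx (odds n) ++ map residue (keep even-residue Y)

  sort-by-side : ∀ n Y → (map idx (range n) ++ map residue Y) ↭ even-labels n Y ++ odd-labels n Y
  sort-by-side n Y =
    Perm.↭-trans (++⁺ (Perm.↭-trans (map⁺ idx (range-by-parity n)) (Perm.↭-reflexive (map-++ idx (evens n) (odds n))))
                      (Perm.↭-trans (map⁺ residue (keep-↭ Y)) (Perm.↭-reflexive (map-++ residue (keep odd-residue Y) _))))
                 (↭-middle (map idx (evens n)) (map idx (odds n)) (map residue (keep odd-residue Y)) _)

  even-labels-side : ∀ n Y → All EvenSide (even-labels n Y)
  even-labels-side n Y = All.++⁺ (evens-side (range ⌈ n /2⌉)) (kept-odd-side Y)

  odd-labels-side : ∀ n Y → All OddSide (odd-labels n Y)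
  odd-labels-side n Y = All.++⁺ (odds-side (range ⌊ n /2⌋)) (kept-even-side Y)

  halve-even-labels : ∀ n Y → map halve (even-labels n Y) ≡ map idx (range ⌈ n /2⌉) ++ map border (map lower (keep odd-residue Y))
  halve-even-labels n Y =
    trans (map-++ halve (map idx (evens n)) _) (cong₂ _++_ (halve-evens (range ⌈ n /2⌉)) (halve-residues (keep odd-residue Y)))

  halve-odd-labels : ∀ n Y → map halve (odd-labels n Y) ≡ map idx (range ⌊ n /2⌋) ++ map border (map lower (keep even-residue Y))
  halve-odd-labels n Y =
    trans (map-++ halve (map idx (odds n)) _) (cong₂ _++_ (halve-odds (range ⌊ n /2⌋)) (halve-residues (keep even-residue Y)))

  open import Data.Nat.Solver using (module +-*-Solver)
  open +-*-Solver using (solve; _:+_; _:=_; con)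

  private
    double-+-double : ∀ p q → (p + p) + (q + q) ≡ (p + q) + (p + q)
    double-+-double = solve 2 (λ p q → (p :+ p) :+ (q :+ q) := (p :+ q) :+ (p :+ q)) refl
    double-+-odd : ∀ p q → (p + p) + suc (q + q) ≡ suc ((p + q) + (p + q))
    double-+-odd = solve 2 (λ p q → (p :+ p) :+ (con 1 :+ (q :+ q)) := con 1 :+ ((p :+ q) :+ (p :+ q))) refl
    odd-+-double : ∀ p q → suc (p + p) + (q + q) ≡ suc ((p + q) + (p + q))
    odd-+-double = solve 2 (λ p q → (con 1 :+ (p :+ p)) :+ (q :+ q) := con 1 :+ ((p :+ q) :+ (p :+ q))) refl
    odd-+-odd : ∀ p q → suc (p + p) + suc (q + q) ≡ suc (p + q) + suc (p + q)
    odd-+-odd = solve 2 (λ p q → (con 1 :+ (p :+ p)) :+ (con 1 :+ (q :+ q)) := (con 1 :+ (p :+ q)) :+ (con 1 :+ (p :+ q))) refl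

  -- The rank-four correction: f(4n) = 1 and f(4n+2) = 0 contribute
  -- ρ₀ρ₀ᵗ + ρ₂ρ₂ᵗ + ρ₁ρ₃ᵗ + ρ₃ρ₁ᵗ (see kernel-decomposition).
  corrections : List (Residue × Residue)
  corrections = (ρ₀ , ρ₀) ∷ (ρ₂ , ρ₂) ∷ (ρ₁ , ρ₃) ∷ (ρ₃ , ρ₁) ∷ []

  recursion-rhs : (List Border → List Border → Bool) → (List Border → List Border → Bool) →
                  List Border → List Border → Bool
  recursion-rhs FA FB U V =
    Σ-refinements (λ U′ → Σ-refinements (λ V′ → Σ-borderings (λ Cs Rs →
          FA (map lower (keep even-residue (U′ ++ Cs))) (map lower (keep odd-residue (V′ ++ Rs)))
        ∧ FB (map lower (keep odd-residue (U′ ++ Cs))) (map lower (keep even-residue (V′ ++ Rs)))) corrections) V) U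

  recursion-rhs-cong : ∀ {FA FA′ FB FB′ : List Border → List Border → Bool} →
    (∀ U V → FA U V ≡ FA′ U V) → (∀ U V → FB U V ≡ FB′ U V) →
    ∀ U V → recursion-rhs FA FB U V ≡ recursion-rhs FA′ FB′ U V
  recursion-rhs-cong eA eB U V = Σ-refinements-cong U (λ U′ → Σ-refinements-cong V (λ V′ →
    Σ-borderings-cong corrections (λ Cs Rs →
      cong₂ _∧_ (eA (map lower (keep even-residue (U′ ++ Cs))) (map lower (keep odd-residue (V′ ++ Rs))))
                (eB (map lower (keep odd-residue (U′ ++ Cs))) (map lower (keep even-residue (V′ ++ Rs)))))))

  module Hankel (P : ℕ → Bool) (P-even : ∀ m → P (m + m) ≡ even m)
                (P-odd : ∀ m → P (suc (m + m)) ≡ P m) where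

    K-hankel K-odd : ℕ → ℕ → Bool
    K-hankel i j = P (i + j)
    K-odd    i j = not (even (i + j)) ∧ P (⌊ i /2⌋ + ⌊ j /2⌋)

    private
      decomposition-even-even : ∀ p q → K-hankel (p + p) (q + q) ≡ add-rank-ones corrections K-odd (p + p) (q + q)
      decomposition-even-even p q
        rewrite double-+-double p q | P-even (p + q) | even-double (p + q) | even-+ p q
              | even-double p | even-double q | ⌊double/2⌋ p | ⌊double/2⌋ q
        with even p | even q
      ... | true  | true  = refl
      ... | true  | false = refl
      ... | false | true  = refl
      ... | false | false = refl

      decomposition-even-odd : ∀ p q → K-hankel (p + p) (suc (q + q)) ≡ add-rank-ones corrections K-odd (p + p) (suc (q + q))
      decomposition-even-odd p q
        rewrite double-+-odd p q | P-odd (p + q) | even-suc-double (p + q)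
              | even-double p | even-suc-double q | ⌊double/2⌋ p | ⌊suc-double/2⌋ q
        with even p | even q | P (p + q)
      ... | true  | true  | true  = refl
      ... | true  | true  | false = refl
      ... | true  | false | true  = refl
      ... | true  | false | false = refl
      ... | false | true  | true  = refl
      ... | false | true  | false = refl
      ... | false | false | true  = refl
      ... | false | false | false = refl

      decomposition-odd-even : ∀ p q → K-hankel (suc (p + p)) (q + q) ≡ add-rank-ones corrections K-odd (suc (p + p)) (q + q)
      decomposition-odd-even p q
        rewrite odd-+-double p q | P-odd (p + q) | even-suc-double (p + q)
              | even-suc-double p | even-double q | ⌊suc-double/2⌋ p | ⌊double/2⌋ q
        with even p | even q | P (p + q)
      ... | true  | true  | true  = refl
      ... | true  | true  | false = refl
      ... | true  | false | true  = refl
      ... | true  | false | false = refl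
      ... | false | true  | true  = refl
      ... | false | true  | false = refl
      ... | false | false | true  = refl
      ... | false | false | false = refl

      decomposition-odd-odd : ∀ p q → K-hankel (suc (p + p)) (suc (q + q)) ≡ add-rank-ones corrections K-odd (suc (p + p)) (suc (q + q))
      decomposition-odd-odd p q
        rewrite odd-+-odd p q | P-even (suc (p + q)) | even-double (suc (p + q)) | even-suc (p + q)
              | even-+ p q | even-suc-double p | even-suc-double q | ⌊suc-double/2⌋ p | ⌊suc-double/2⌋ q
        with even p | even q
      ... | true  | true  = refl
      ... | true  | false = refl
      ... | false | true  = refl
      ... | false | false = refl

    kernel-decomposition : ∀ i j → K-hankel i j ≡ add-rank-ones corrections K-odd i j
    kernel-decomposition i j with parityView i | parityView j
    ... | even-view p | even-view q = decomposition-even-even p q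
    ... | even-view p | odd-view q  = decomposition-even-odd p q
    ... | odd-view p  | even-view q = decomposition-odd-even p q
    ... | odd-view p  | odd-view q  = decomposition-odd-odd p q

    private
      zero-even-even : ∀ x y → EvenSide x → EvenSide y → bordered K-odd x y ≡ false
      zero-even-even _ _ (even-idx p) (even-idx q)
        rewrite double-+-double p q | even-double (p + q) = refl
      zero-even-even _ _ (even-idx p) ρ₁-side rewrite even-double p = refl
      zero-even-even _ _ (even-idx p) ρ₃-side rewrite even-double p = refl
      zero-even-even _ _ ρ₁-side (even-idx q) rewrite even-double q = refl
      zero-even-even _ _ ρ₃-side (even-idx q) rewrite even-double q = refl
      zero-even-even _ _ ρ₁-side ρ₁-side = refl
      zero-even-even _ _ ρ₁-side ρ₃-side = refl
      zero-even-even _ _ ρ₃-side ρ₁-side = refl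
      zero-even-even _ _ ρ₃-side ρ₃-side = refl

      zero-odd-odd : ∀ x y → OddSide x → OddSide y → bordered K-odd x y ≡ false
      zero-odd-odd _ _ (odd-idx p) (odd-idx q)
        rewrite odd-+-odd p q | even-double (suc (p + q)) = refl
      zero-odd-odd _ _ (odd-idx p) ρ₀-side rewrite even-suc-double p = refl
      zero-odd-odd _ _ (odd-idx p) ρ₂-side rewrite even-suc-double p = refl
      zero-odd-odd _ _ ρ₀-side (odd-idx q) rewrite even-suc-double q = refl
      zero-odd-odd _ _ ρ₂-side (odd-idx q) rewrite even-suc-double q = refl
      zero-odd-odd _ _ ρ₀-side ρ₀-side = refl
      zero-odd-odd _ _ ρ₀-side ρ₂-side = refl
      zero-odd-odd _ _ ρ₂-side ρ₀-side = refl
      zero-odd-odd _ _ ρ₂-side ρ₂-side = refl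

      halve-even-odd : ∀ x y → EvenSide x → OddSide y → bordered K-odd x y ≡ bordered K-hankel (halve x) (halve y)
      halve-even-odd _ _ (even-idx p) (odd-idx q)
        rewrite double-+-odd p q | even-suc-double (p + q) | ⌊double/2⌋ p | ⌊suc-double/2⌋ q = refl
      halve-even-odd _ _ (even-idx p) ρ₀-side rewrite even-double p | ⌊double/2⌋ p = refl
      halve-even-odd _ _ (even-idx p) ρ₂-side rewrite even-double p | ⌊double/2⌋ p = refl
      halve-even-odd _ _ ρ₁-side (odd-idx q) rewrite even-suc-double q | ⌊suc-double/2⌋ q = refl
      halve-even-odd _ _ ρ₃-side (odd-idx q) rewrite even-suc-double q | ⌊suc-double/2⌋ q = refl
      halve-even-odd _ _ ρ₁-side ρ₀-side = refl
      halve-even-odd _ _ ρ₁-side ρ₂-side = refl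
      halve-even-odd _ _ ρ₃-side ρ₀-side = refl
      halve-even-odd _ _ ρ₃-side ρ₂-side = refl

      halve-odd-even : ∀ x y → OddSide x → EvenSide y → bordered K-odd x y ≡ bordered K-hankel (halve x) (halve y)
      halve-odd-even _ _ (odd-idx p) (even-idx q)
        rewrite odd-+-double p q | even-suc-double (p + q) | ⌊suc-double/2⌋ p | ⌊double/2⌋ q = refl
      halve-odd-even _ _ (odd-idx p) ρ₁-side rewrite even-suc-double p | ⌊suc-double/2⌋ p = refl
      halve-odd-even _ _ (odd-idx p) ρ₃-side rewrite even-suc-double p | ⌊suc-double/2⌋ p = refl
      halve-odd-even _ _ ρ₀-side (even-idx q) rewrite even-double q | ⌊double/2⌋ q = refl
      halve-odd-even _ _ ρ₂-side (even-idx q) rewrite even-double q | ⌊double/2⌋ q = refl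
      halve-odd-even _ _ ρ₀-side ρ₁-side = refl
      halve-odd-even _ _ ρ₀-side ρ₃-side = refl
      halve-odd-even _ _ ρ₂-side ρ₁-side = refl
      halve-odd-even _ _ ρ₂-side ρ₃-side = refl

    Δ : ℕ → ℕ → List Border → List Border → Bool
    Δ r s U V = det₂ (bordered K-hankel) (map idx (range r) ++ map border V) (map idx (range s) ++ map border U)

    -- With refined residue borders, the odd part is block diagonal after
    -- sorting rows and columns by parity, and both blocks are Δ's of half size.
    halving : ∀ r s W Z →
      det₂ (bordered K-odd) (map idx (range r) ++ map residue W) (map idx (range s) ++ map residue Z)
      ≡ Δ ⌈ r /2⌉ ⌊ s /2⌋ (map lower (keep even-residue Z)) (map lower (keep odd-residue W))
        ∧ Δ ⌊ r /2⌋ ⌈ s /2⌉ (map lower (keep odd-residue Z)) (map lower (keep even-residue W))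
    halving r s W Z = begin
        det₂ (bordered K-odd) (map idx (range r) ++ map residue W) (map idx (range s) ++ map residue Z)
      ≡⟨ det₂-perm (bordered K-odd) (sort-by-side r W) (map idx (range s) ++ map residue Z) ⟩
        det₂ (bordered K-odd) (even-labels r W ++ odd-labels r W) (map idx (range s) ++ map residue Z)
      ≡⟨ det₂-column-perm (bordered K-odd) (even-labels r W ++ odd-labels r W) (Perm.↭-trans (sort-by-side s Z) (++-comm (even-labels s Z) _)) ⟩
        det₂ (bordered K-odd) (even-labels r W ++ odd-labels r W) (odd-labels s Z ++ even-labels s Z)
      ≡⟨ BlockDiagonal.block-diagonal (bordered K-odd) EvenSide OddSide OddSide EvenSide zero-even-even zero-odd-odd
           (even-labels-side r W) (odd-labels-side r W) (odd-labels-side s Z) (even-labels-side s Z) ⟩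
        det₂ (bordered K-odd) (even-labels r W) (odd-labels s Z) ∧ det₂ (bordered K-odd) (odd-labels r W) (even-labels s Z)
      ≡⟨ cong₂ _∧_ (trans (halved halve-even-odd (even-labels-side r W) (odd-labels-side s Z))
                          (cong₂ (det₂ (bordered K-hankel)) (halve-even-labels r W) (halve-odd-labels s Z)))
                   (trans (halved halve-odd-even (odd-labels-side r W) (even-labels-side s Z))
                          (cong₂ (det₂ (bordered K-hankel)) (halve-odd-labels r W) (halve-even-labels s Z))) ⟩
        Δ ⌈ r /2⌉ ⌊ s /2⌋ (map lower (keep even-residue Z)) (map lower (keep odd-residue W))
          ∧ Δ ⌊ r /2⌋ ⌈ s /2⌉ (map lower (keep odd-residue Z)) (map lower (keep even-residue W)) ∎
      where
      open ≡-Reasoning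

      halved : ∀ {S T : Label → Set} →
               (∀ x y → S x → T y → bordered K-odd x y ≡ bordered K-hankel (halve x) (halve y)) →
               ∀ {rs cs} → All S rs → All T cs →
               det₂ (bordered K-odd) rs cs ≡ det₂ (bordered K-hankel) (map halve rs) (map halve cs)
      halved agree {rs} {cs} S-rs T-cs =
        trans (det₂-congᴬ agree S-rs T-cs) (sym (det₂-map (bordered K-hankel) halve halve rs cs))

    -- The halving recursion: refine the borders, split the kernel into its
    -- odd part and rank-one terms, and apply halving to each term.
    Δ-recursion : ∀ r s U V → Δ r s U V ≡ recursion-rhs (Δ ⌈ r /2⌉ ⌊ s /2⌋) (Δ ⌊ r /2⌋ ⌈ s /2⌉) U V
    Δ-recursion r s U V =
      trans (Refine.refine-columns K-hankel U rows (map idx (range s)))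
      (Σ-refinements-cong U (λ U′ →
        trans (Refine.refine-rows K-hankel V (map idx (range s) ++ map residue U′) (map idx (range r)))
        (Σ-refinements-cong V (λ V′ →
          trans (det₂-cong kernel-agrees (map idx (range r) ++ map residue V′) (map idx (range s) ++ map residue U′))
          (trans (rank-ones-expansion corrections K-odd (map idx (range r) ++ map residue V′) (map idx (range s) ++ map residue U′))
          (Σ-borderings-cong corrections (λ Cs Rs →
            trans (cong₂ (det₂ (bordered K-odd)) (regroup (range r) V′ Rs) (regroup (range s) U′ Cs))
                  (halving r s (V′ ++ Rs) (U′ ++ Cs)))))))))
      where
      rows = map idx (range r) ++ map border V

      kernel-agrees : ∀ x y → bordered K-hankel x y ≡ bordered (add-rank-ones corrections K-odd) x y
      kernel-agrees (idx i) (idx j) = kernel-decomposition i j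
      kernel-agrees (idx i) (vec w) = refl
      kernel-agrees (vec w) (idx j) = refl
      kernel-agrees (vec w) (vec _) = refl

      regroup : ∀ I W W′ → (map idx I ++ map residue W) ++ map residue W′ ≡ map idx I ++ map residue (W ++ W′)
      regroup I W W′ = trans (++-assoc (map idx I) (map residue W) _) (cong (map idx I ++_) (sym (map-++ residue W W′)))

module Mod2 where

  open import Defs using (pfAux; pf; sumFin; sign; det; detℕ; α; β)
  open Det₂
  open BorderedHankel
    using (even; even-+; even-double; even-suc-double; ⌊double/2⌋; ⌊suc-double/2⌋; parityView; even-view; odd-view; range)

  open import Data.Bool using (Bool; true; false; _∧_; _xor_; not; if_then_else_)
  open import Data.Fin using (Fin; toℕ; punchIn) renaming (zero to fzero; suc to fsuc)
  open import Data.Integer as ℤ using (ℤ; +_; -[1+_]; ∣_∣; _⊖_)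
  open import Data.Integer.Properties using ([1+m]⊖[1+n]≡m⊖n; ∣i*j∣≡∣i∣*∣j∣)
  open import Data.List using (List; []; _∷_; map; tabulate; [_])
  open import Data.List.Properties using (map-tabulate; map-++)
  open import Data.Nat as ℕ using (ℕ; zero; suc; _%_; _/_; _<_; z≤n; s≤s; ⌊_/2⌋; parity)
  open import Data.Nat.DivMod using ([m+n]%n≡m%n; m/n≡1+[m∸n]/n)
  open import Data.Nat.Properties using (+-suc; +-identityʳ; +-comm; ≤-trans; ≤-refl; m≤m+n)
  open import Data.Parity.Base using (0ℙ; 1ℙ)
  import Data.Parity.Properties as ℙ
  open import Data.Product using (_×_; _,_; proj₁; proj₂)
  open import Relation.Binary.PropositionalEquality hiding ([_])

  oddℤ : ℤ → Bool
  oddℤ z = not (even ∣ z ∣)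

  private
    even-⊖ : ∀ m n → even ∣ m ⊖ n ∣ ≡ even (m ℕ.+ n)
    even-⊖ m       zero    = cong even (sym (+-identityʳ m))
    even-⊖ zero    (suc n) = refl
    even-⊖ (suc m) (suc n) rewrite [1+m]⊖[1+n]≡m⊖n m n | +-suc m n = even-⊖ m n

    even-∣+∣ : ∀ x y → even ∣ x ℤ.+ y ∣ ≡ even (∣ x ∣ ℕ.+ ∣ y ∣)
    even-∣+∣ (+ m)    (+ n)    = refl
    even-∣+∣ (+ m)    -[1+ n ] = even-⊖ m (suc n)
    even-∣+∣ -[1+ m ] (+ n)    = trans (even-⊖ n (suc m)) (cong even (+-comm n (suc m)))
    even-∣+∣ -[1+ m ] -[1+ n ] = cong even (cong suc (sym (+-suc m n)))

  oddℤ-+ : ∀ x y → oddℤ (x ℤ.+ y) ≡ oddℤ x xor oddℤ y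
  oddℤ-+ x y rewrite even-∣+∣ x y | even-+ ∣ x ∣ ∣ y ∣ with even ∣ x ∣ | even ∣ y ∣
  ... | true  | true  = refl
  ... | true  | false = refl
  ... | false | true  = refl
  ... | false | false = refl

  oddℤ-* : ∀ x y → oddℤ (x ℤ.* y) ≡ oddℤ x ∧ oddℤ y
  oddℤ-* x y rewrite ∣i*j∣≡∣i∣*∣j∣ x y | ℙ.*-homo-* ∣ x ∣ ∣ y ∣ with parity ∣ x ∣ | parity ∣ y ∣
  ... | 0ℙ | _  = refl
  ... | 1ℙ | 0ℙ = refl
  ... | 1ℙ | 1ℙ = refl

  oddℤ-sign : ∀ k → oddℤ (sign k) ≡ true
  oddℤ-sign zero          = refl
  oddℤ-sign (suc zero)    = refl
  oddℤ-sign (suc (suc k)) = oddℤ-sign k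

  %2≡ : ∀ n → n % 2 ≡ (if even n then 0 else 1)
  %2≡ 0 = refl
  %2≡ 1 = refl
  %2≡ (suc (suc n)) = trans (trans (cong (_% 2) (+-comm 2 n)) ([m+n]%n≡m%n n 2)) (%2≡ n)

  ∣∣%2 : ∀ z → ∣ z ∣ % 2 ≡ (if oddℤ z then 1 else 0)
  ∣∣%2 z rewrite %2≡ ∣ z ∣ with even ∣ z ∣
  ... | true  = refl
  ... | false = refl

  private
    Σ₂-Fin : ∀ {n} → (Fin n → Bool) → Bool
    Σ₂-Fin {zero}  g = false
    Σ₂-Fin {suc n} g = g fzero xor Σ₂-Fin (λ j → g (fsuc j))

    Σ₂-Fin-cong : ∀ {n} {f g : Fin n → Bool} → (∀ j → f j ≡ g j) → Σ₂-Fin f ≡ Σ₂-Fin g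
    Σ₂-Fin-cong {zero}  f≡g = refl
    Σ₂-Fin-cong {suc n} f≡g = cong₂ _xor_ (f≡g fzero) (Σ₂-Fin-cong (λ j → f≡g (fsuc j)))

    oddℤ-sumFin : ∀ {n} (g : Fin n → ℤ) → oddℤ (sumFin g) ≡ Σ₂-Fin (λ j → oddℤ (g j))
    oddℤ-sumFin {zero}  g = refl
    oddℤ-sumFin {suc n} g =
      trans (oddℤ-+ (g fzero) _) (cong (oddℤ (g fzero) xor_) (oddℤ-sumFin (λ j → g (fsuc j))))

    tabulate-punchIn : ∀ {X : Set} {n} (κ : Fin (suc (suc n)) → X) (j : Fin (suc n)) →
      tabulate (λ k → κ (punchIn (fsuc j) k)) ≡ κ fzero ∷ tabulate (λ k → κ (fsuc (punchIn j k)))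
    tabulate-punchIn κ fzero    = refl
    tabulate-punchIn κ (fsuc j) = refl

    Σ₂-picks-tabulate : ∀ {X : Set} n (κ : Fin (suc n) → X) (F : X × List X → Bool) →
      Σ₂ F (picks (tabulate κ)) ≡ Σ₂-Fin (λ j → F (κ j , tabulate (λ k → κ (punchIn j k))))
    Σ₂-picks-tabulate zero    κ F = refl
    Σ₂-picks-tabulate (suc n) κ F =
      cong (F (κ fzero , tabulate (λ k → κ (fsuc k))) xor_)
        (trans (Σ₂-map F _ (picks (tabulate (λ k → κ (fsuc k)))))
        (trans (Σ₂-picks-tabulate n (λ k → κ (fsuc k)) (λ p → F (proj₁ p , κ fzero ∷ proj₂ p)))
               (Σ₂-Fin-cong (λ j → cong (λ l → F (κ (fsuc j) , l)) (sym (tabulate-punchIn κ j))))))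

  oddℤ-det : ∀ n (ρ κ : Fin n → ℕ) (M : ℕ → ℕ → ℤ) →
    oddℤ (det n (λ i k → M (ρ i) (κ k))) ≡ det₂ (λ x y → oddℤ (M x y)) (tabulate ρ) (tabulate κ)
  oddℤ-det zero    ρ κ M = refl
  oddℤ-det (suc n) ρ κ M =
    trans (oddℤ-sumFin (λ j → sign (toℕ j) ℤ.* M (ρ fzero) (κ j) ℤ.* minor j))
    (trans (Σ₂-Fin-cong (λ j →
       trans (oddℤ-* (sign (toℕ j) ℤ.* M (ρ fzero) (κ j)) (minor j))
       (cong₂ _∧_ (trans (oddℤ-* (sign (toℕ j)) (M (ρ fzero) (κ j)))
                         (cong (_∧ oddℤ (M (ρ fzero) (κ j))) (oddℤ-sign (toℕ j))))
                  (oddℤ-det n (λ i → ρ (fsuc i)) (λ k → κ (punchIn j k)) M))))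
    (sym (Σ₂-picks-tabulate n κ
      (λ p → oddℤ (M (ρ fzero) (proj₁ p)) ∧ det₂ (λ x y → oddℤ (M x y)) (tabulate (λ i → ρ (fsuc i))) (proj₂ p)))))
    where
    minor : Fin (suc n) → ℤ
    minor j = det n (λ i k → M (ρ (fsuc i)) (κ (punchIn j k)))

  tabulate-toℕ : ∀ n → tabulate {n = n} toℕ ≡ range n
  tabulate-toℕ zero    = refl
  tabulate-toℕ (suc n) = trans (cong (0 ∷_) (trans (sym (map-tabulate toℕ suc)) (cong (map suc) (tabulate-toℕ n))))
                               (sym (range-suc n))
    where
    range-suc : ∀ n → range (suc n) ≡ 0 ∷ map suc (range n)
    range-suc zero    = refl
    range-suc (suc n) = trans (cong (λ l → l Data.List.++ [ suc n ]) (range-suc n))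
                              (cong (0 ∷_) (sym (map-++ suc (range n) [ n ])))

  oddℤ-detℕ : ∀ k (M : ℕ → ℕ → ℤ) → oddℤ (detℕ k M) ≡ det₂ (λ x y → oddℤ (M x y)) (range k) (range k)
  oddℤ-detℕ k M = trans (oddℤ-det k toℕ toℕ M) (cong₂ (det₂ (λ x y → oddℤ (M x y))) (tabulate-toℕ k) (tabulate-toℕ k))

  oddℤ-α : ∀ i → oddℤ (α i) ≡ even i
  oddℤ-α i rewrite %2≡ i with even i
  ... | true  = refl
  ... | false = refl

  oddℤ-β : ∀ i → oddℤ (β i) ≡ not (even i)
  oddℤ-β i rewrite %2≡ i with even i
  ... | true  = refl
  ... | false = refl

  pf₂ : ℕ → Bool
  pf₂ n = oddℤ (pf n)

  private
    residue4 : Bool → Bool → ℕ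
    residue4 true  true  = 0
    residue4 false true  = 1
    residue4 true  false = 2
    residue4 false false = 3

    %4≡ : ∀ n → n % 4 ≡ residue4 (even n) (even ⌊ n /2⌋)
    %4≡ 0 = refl
    %4≡ 1 = refl
    %4≡ 2 = refl
    %4≡ 3 = refl
    %4≡ (suc (suc (suc (suc n)))) = trans (trans (cong (_% 4) (+-comm 4 n)) ([m+n]%n≡m%n n 4)) (%4≡ n)

    /2≡ : ∀ n → n / 2 ≡ ⌊ n /2⌋
    /2≡ 0 = refl
    /2≡ 1 = refl
    /2≡ (suc (suc n)) = trans (m/n≡1+[m∸n]/n {suc (suc n)} {2} (s≤s (s≤s z≤n))) (cong suc (/2≡ n))

    pfAux-step : ∀ k n → pfAux (suc k) n ≡
                 (if even n then (if even ⌊ n /2⌋ then + 1 else + 0) else pfAux k ⌊ n /2⌋)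
    pfAux-step k n with even n | even ⌊ n /2⌋ | n % 4 | %4≡ n
    ... | true  | true  | _ | refl = refl
    ... | false | true  | _ | refl = cong (pfAux k) (/2≡ n)
    ... | true  | false | _ | refl = refl
    ... | false | false | _ | refl = cong (pfAux k) (/2≡ n)

    pfAux-fuel : ∀ f g n → n < f → n < g → pfAux f n ≡ pfAux g n
    pfAux-fuel (suc f) (suc g) n n<f n<g with parityView n
    ... | even-view p rewrite pfAux-step f (p ℕ.+ p) | pfAux-step g (p ℕ.+ p) | even-double p = refl
    ... | odd-view p
      rewrite pfAux-step f (suc (p ℕ.+ p)) | pfAux-step g (suc (p ℕ.+ p)) | even-suc-double p | ⌊suc-double/2⌋ p =
      pfAux-fuel f g p (half< n<f) (half< n<g)
      where
      half< : ∀ {h} → suc (p ℕ.+ p) < suc h → p < h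
      half< (s≤s le) = ≤-trans (s≤s (m≤m+n p p)) le

  pf₂-even : ∀ m → pf₂ (m ℕ.+ m) ≡ even m
  pf₂-even m rewrite pfAux-step (m ℕ.+ m) (m ℕ.+ m) | even-double m | ⌊double/2⌋ m with even m
  ... | true  = refl
  ... | false = refl

  pf₂-odd : ∀ m → pf₂ (suc (m ℕ.+ m)) ≡ pf₂ m
  pf₂-odd m rewrite pfAux-step (suc (m ℕ.+ m)) (suc (m ℕ.+ m)) | even-suc-double m | ⌊suc-double/2⌋ m =
    cong oddℤ (pfAux-fuel (suc (m ℕ.+ m)) (suc m) m (s≤s (m≤m+n m m)) (s≤s ≤-refl))

module Paperfolding where

  open import Defs using (pf; detℕ; α; β; a; b; c; d; e; g; h; x; y)
  open Det₂
  open BorderedHankel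
  open Mod2

  open import Data.Bool using (Bool; true; false; if_then_else_)
  open import Data.Bool.Properties using (_≟_)
  open import Data.Bool.ListAction using (any)
  open import Data.Integer using (ℤ; +_)
  open import Data.List using (List; []; _∷_; _++_; map; [_]; replicate; upTo; cartesianProduct)
  open import Data.List.Properties using (++-identityʳ; map-++; ++-assoc)
  open import Data.List.Membership.Propositional using (_∈_)
  open import Data.List.Membership.Propositional.Properties using (∈-upTo⁺; ∈-cartesianProduct⁺)
  open import Data.List.Relation.Unary.All as All using (all?)
  open import Data.List.Relation.Unary.Any using (here; there)
  open import Data.List.Relation.Binary.Permutation.Propositional as Perm using (_↭_)
  open import Data.List.Relation.Binary.Permutation.Propositional.Properties using (shift; ++-comm; ++⁺ˡ; map⁺)
  open import Data.Maybe using (Maybe; just; nothing)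
  open import Data.Nat as ℕ using (ℕ; zero; suc; _<_; z≤n; s≤s; _%_; _<ᵇ_; _≡ᵇ_; ⌊_/2⌋; ⌈_/2⌉)
  open import Data.Nat.DivMod using (%-distribˡ-+; m%n<n)
  open import Data.Nat.Induction using (<-rec)
  open import Data.Nat.Properties using (+-comm; ≤-refl; m≤n⇒m≤1+n; m<m+n; m≤n+m; m<n⇒m<1+n)
  open import Data.Product using (_×_; _,_; proj₁; proj₂)
  open import Relation.Binary.PropositionalEquality hiding ([_])
  open import Relation.Nullary.Decidable using (True; toWitness)

  open Hankel pf₂ pf₂-even pf₂-odd public

  by-evaluation : ∀ {X : Set} (xs : List X) (f g : X → Bool) →
                  {_ : True (all? (λ x → f x ≟ g x) xs)} → ∀ {x} → x ∈ xs → f x ≡ g x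
  by-evaluation xs f g {ok} = All.lookup (toWitness ok)

  data BorderSet : Set where
    ∅ ⟨α⟩ ⟨β⟩ ⟨αβ⟩ : BorderSet

  elements : BorderSet → List Border
  elements ∅    = []
  elements ⟨α⟩  = αb ∷ []
  elements ⟨β⟩  = βb ∷ []
  elements ⟨αβ⟩ = αb ∷ βb ∷ []

  count : Border → List Border → ℕ
  count _  []       = 0
  count αb (αb ∷ U) = suc (count αb U)
  count αb (βb ∷ U) = count αb U
  count βb (αb ∷ U) = count βb U
  count βb (βb ∷ U) = suc (count βb U)

  with-counts : ℕ → ℕ → Maybe BorderSet
  with-counts 0 0 = just ∅
  with-counts 1 0 = just ⟨α⟩
  with-counts 0 1 = just ⟨β⟩
  with-counts 1 1 = just ⟨αβ⟩
  with-counts _ _ = nothing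

  set-of : List Border → Maybe BorderSet
  set-of U = with-counts (count αb U) (count βb U)

  -- Δ on border sets; a repeated border gives 0.
  Δ̂ : ℕ → ℕ → Maybe BorderSet → Maybe BorderSet → Bool
  Δ̂ r s (just u) (just v) = Δ r s (elements u) (elements v)
  Δ̂ r s _        _        = false

  private
    -- Every border list is a permutation of a sorted list α…αβ…β, which is
    -- either a set or has a repeated border.
    sorted : ℕ → ℕ → List Border
    sorted a b = replicate a αb ++ replicate b βb

    ↭-sorted : ∀ U → U ↭ sorted (count αb U) (count βb U)
    ↭-sorted []       = Perm.refl
    ↭-sorted (αb ∷ U) = Perm.prep αb (↭-sorted U)
    ↭-sorted (βb ∷ U) =
      Perm.↭-trans (Perm.prep βb (↭-sorted U)) (Perm.↭-sym (shift βb (replicate (count αb U) αb) _))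

    data SortedView (a b : ℕ) : Set where
      is-set   : ∀ u → with-counts a b ≡ just u → sorted a b ≡ elements u → SortedView a b
      repeated : ∀ x L → with-counts a b ≡ nothing → sorted a b ↭ x ∷ x ∷ L → SortedView a b

    sortedView : ∀ a b → SortedView a b
    sortedView 0 0 = is-set ∅ refl refl
    sortedView 1 0 = is-set ⟨α⟩ refl refl
    sortedView 0 1 = is-set ⟨β⟩ refl refl
    sortedView 1 1 = is-set ⟨αβ⟩ refl refl
    sortedView (suc (suc a)) b = repeated αb _ refl Perm.refl
    sortedView 0 (suc (suc b)) = repeated βb _ refl Perm.refl
    sortedView 1 (suc (suc b)) = repeated βb (αb ∷ replicate b βb) refl
      (Perm.↭-trans (Perm.swap αb βb Perm.refl) (Perm.prep βb (Perm.swap αb βb Perm.refl)))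

    Δ-↭-columns : ∀ r s {U U′} V → U ↭ U′ → Δ r s U V ≡ Δ r s U′ V
    Δ-↭-columns r s V p = det₂-column-perm (bordered K-hankel) (map idx (range r) ++ map border V)
                            (++⁺ˡ (map idx (range s)) (map⁺ border p))

    Δ-↭-rows : ∀ r s U {V V′} → V ↭ V′ → Δ r s U V ≡ Δ r s U V′
    Δ-↭-rows r s U p = det₂-perm (bordered K-hankel) (++⁺ˡ (map idx (range r)) (map⁺ border p))
                         (map idx (range s) ++ map border U)

    Δ-repeated-column : ∀ r s {U} x L V → U ↭ x ∷ x ∷ L → Δ r s U V ≡ false
    Δ-repeated-column r s x L V p =
      trans (Δ-↭-columns r s V p)
      (trans (det₂-column-perm (bordered K-hankel) rows (++-comm (map idx (range s)) (map border (x ∷ x ∷ L))))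
             (det₂-equal-columns (bordered K-hankel) (border x) (border x) (λ _ → refl) rows
               (map border L ++ map idx (range s))))
      where rows = map idx (range r) ++ map border V

    Δ-repeated-row : ∀ r s U {V} x L → V ↭ x ∷ x ∷ L → Δ r s U V ≡ false
    Δ-repeated-row r s U x L p =
      trans (Δ-↭-rows r s U p)
      (trans (det₂-perm (bordered K-hankel) (++-comm (map idx (range r)) (map border (x ∷ x ∷ L))) cols)
             (det₂-equal-rows (bordered K-hankel) (border x) (border x) (λ _ → refl)
               (map border L ++ map idx (range r)) cols))
      where cols = map idx (range s) ++ map border U

  Δ-normal : ∀ r s U V → Δ r s U V ≡ Δ̂ r s (set-of U) (set-of V)
  Δ-normal r s U V
    rewrite Δ-↭-columns r s V (↭-sorted U) | Δ-↭-rows r s (sorted (count αb U) (count βb U)) (↭-sorted V)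
    with sortedView (count αb U) (count βb U) | sortedView (count αb V) (count βb V)
  ... | repeated x L e p | _ rewrite e = Δ-repeated-column r s x L _ p
  ... | is-set u e₁ e₂ | repeated x L e p rewrite e | e₁ = Δ-repeated-row r s _ x L p
  ... | is-set u e₁ e₂ | is-set v e₃ e₄ rewrite e₁ | e₂ | e₃ | e₄ = refl

  data Shape : Set where
    square tall wide : Shape

  rows cols : Shape → ℕ → ℕ
  rows square n = n
  rows tall   n = suc n
  rows wide   n = n
  cols square n = n
  cols tall   n = n
  cols wide   n = suc n

  residues-in : List ℕ → ℕ → Bool
  residues-in L k = any (λ r → r ≡ᵇ k) L

  -- The claimed values of Δ, as functions of n mod 10.  Besides the nine
  -- determinants of the theorem, the table contains their transposes.
  table : Shape → BorderSet → BorderSet → ℕ → Bool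
  table square ∅    ∅    = residues-in (0 ∷ 1 ∷ 2 ∷ 5 ∷ 8 ∷ 9 ∷ [])
  table square ⟨α⟩  ⟨α⟩  = residues-in (1 ∷ 5 ∷ 9 ∷ [])
  table square ⟨α⟩  ⟨β⟩  = residues-in (2 ∷ 5 ∷ 8 ∷ [])
  table square ⟨β⟩  ⟨α⟩  = residues-in (2 ∷ 5 ∷ 8 ∷ [])
  table square ⟨β⟩  ⟨β⟩  = residues-in (2 ∷ 3 ∷ 4 ∷ 5 ∷ 6 ∷ 7 ∷ 8 ∷ [])
  table square ⟨αβ⟩ ⟨αβ⟩ = residues-in (2 ∷ 4 ∷ 6 ∷ 8 ∷ [])
  table tall   ⟨α⟩  ∅    = residues-in (0 ∷ 1 ∷ 8 ∷ 9 ∷ [])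
  table tall   ⟨β⟩  ∅    = residues-in (1 ∷ 2 ∷ 4 ∷ 5 ∷ 7 ∷ 8 ∷ [])
  table tall   ⟨αβ⟩ ⟨α⟩  = residues-in (1 ∷ 4 ∷ 5 ∷ 8 ∷ [])
  table tall   ⟨αβ⟩ ⟨β⟩  = residues-in (2 ∷ 3 ∷ 4 ∷ 5 ∷ 6 ∷ 7 ∷ [])
  table wide   ∅    ⟨α⟩  = residues-in (0 ∷ 1 ∷ 8 ∷ 9 ∷ [])
  table wide   ∅    ⟨β⟩  = residues-in (1 ∷ 2 ∷ 4 ∷ 5 ∷ 7 ∷ 8 ∷ [])
  table wide   ⟨α⟩  ⟨αβ⟩ = residues-in (1 ∷ 4 ∷ 5 ∷ 8 ∷ [])
  table wide   ⟨β⟩  ⟨αβ⟩ = residues-in (2 ∷ 3 ∷ 4 ∷ 5 ∷ 6 ∷ 7 ∷ [])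
  table _      _    _    = λ _ → false

  tablê : Shape → Maybe BorderSet → Maybe BorderSet → ℕ → Bool
  tablê sh (just u) (just v) k = table sh u v k
  tablê sh _        _        k = false

  Table : ℕ → Set
  Table n = ∀ sh U V → Δ (rows sh n) (cols sh n) U V ≡ tablê sh (set-of U) (set-of V) (n % 10)

  Table-on-sets : ℕ → Set
  Table-on-sets n = ∀ sh u v → Δ (rows sh n) (cols sh n) (elements u) (elements v) ≡ table sh u v (n % 10)

  from-sets : ∀ n → Table-on-sets n → Table n
  from-sets n T sh U V rewrite Δ-normal (rows sh n) (cols sh n) U V with set-of U | set-of V
  ... | just u  | just v  = T sh u v
  ... | just u  | nothing = refl
  ... | nothing | _       = refl

  -- n = 2p + b, and the two half-size subproblems of each shape: the shape
  -- and whether its size is p (false) or p + 1 (true).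
  twice+ : Bool → ℕ → ℕ
  twice+ false p = p ℕ.+ p
  twice+ true  p = suc (p ℕ.+ p)

  half-A half-B : Shape → Bool → Shape × Bool
  half-A square false = square , false
  half-A square true  = tall   , false
  half-A tall   _     = tall   , false
  half-A wide   false = square , false
  half-A wide   true  = square , true
  half-B square false = square , false
  half-B square true  = wide   , false
  half-B tall   false = square , false
  half-B tall   true  = square , true
  half-B wide   _     = wide   , false

  at : Bool → ℕ → ℕ
  at o p = if o then suc p else p

  sizes-A : ∀ sh b p → (⌈ rows sh (twice+ b p) /2⌉ , ⌊ cols sh (twice+ b p) /2⌋)
                       ≡ (rows (proj₁ (half-A sh b)) (at (proj₂ (half-A sh b)) p) , cols (proj₁ (half-A sh b)) (at (proj₂ (half-A sh b)) p))
  sizes-A square false p = cong₂ _,_ (⌊suc-double/2⌋ p) (⌊double/2⌋ p)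
  sizes-A square true  p = cong₂ _,_ (cong suc (⌊double/2⌋ p)) (⌊suc-double/2⌋ p)
  sizes-A tall   false p = cong₂ _,_ (cong suc (⌊double/2⌋ p)) (⌊double/2⌋ p)
  sizes-A tall   true  p = cong₂ _,_ (cong suc (⌊suc-double/2⌋ p)) (⌊suc-double/2⌋ p)
  sizes-A wide   false p = cong₂ _,_ (⌊suc-double/2⌋ p) (⌊suc-double/2⌋ p)
  sizes-A wide   true  p = cong₂ _,_ (cong suc (⌊double/2⌋ p)) (cong suc (⌊double/2⌋ p))

  sizes-B : ∀ sh b p → (⌊ rows sh (twice+ b p) /2⌋ , ⌈ cols sh (twice+ b p) /2⌉)
                       ≡ (rows (proj₁ (half-B sh b)) (at (proj₂ (half-B sh b)) p) , cols (proj₁ (half-B sh b)) (at (proj₂ (half-B sh b)) p))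
  sizes-B square false p = cong₂ _,_ (⌊double/2⌋ p) (⌊suc-double/2⌋ p)
  sizes-B square true  p = cong₂ _,_ (⌊suc-double/2⌋ p) (cong suc (⌊double/2⌋ p))
  sizes-B tall   false p = cong₂ _,_ (⌊suc-double/2⌋ p) (⌊suc-double/2⌋ p)
  sizes-B tall   true  p = cong₂ _,_ (cong suc (⌊double/2⌋ p)) (cong suc (⌊double/2⌋ p))
  sizes-B wide   false p = cong₂ _,_ (⌊double/2⌋ p) (cong suc (⌊double/2⌋ p))
  sizes-B wide   true  p = cong₂ _,_ (⌊suc-double/2⌋ p) (cong suc (⌊suc-double/2⌋ p))

  table-at : Shape × Bool → ℕ → List Border → List Border → Bool
  table-at (sh , o) k U V = tablê sh (set-of U) (set-of V) (if o then suc k % 10 else k)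

  shapes : List Shape
  shapes = square ∷ tall ∷ wide ∷ []

  ∈-shapes : ∀ sh → sh ∈ shapes
  ∈-shapes square = here refl
  ∈-shapes tall   = there (here refl)
  ∈-shapes wide   = there (there (here refl))

  bools : List Bool
  bools = false ∷ true ∷ []

  ∈-bools : ∀ b → b ∈ bools
  ∈-bools false = here refl
  ∈-bools true  = there (here refl)

  sets : List BorderSet
  sets = ∅ ∷ ⟨α⟩ ∷ ⟨β⟩ ∷ ⟨αβ⟩ ∷ []

  ∈-sets : ∀ u → u ∈ sets
  ∈-sets ∅    = here refl
  ∈-sets ⟨α⟩  = there (here refl)
  ∈-sets ⟨β⟩  = there (there (here refl))
  ∈-sets ⟨αβ⟩ = there (there (there (here refl)))

  halving-table : ∀ sh b u v k → k < 10 →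
    recursion-rhs (table-at (half-A sh b) k) (table-at (half-B sh b) k) (elements u) (elements v)
    ≡ table sh u v (twice+ b k % 10)
  halving-table sh b u v k k<10 =
    by-evaluation cases
      (λ { (sh , b , u , v , k) → recursion-rhs (table-at (half-A sh b) k) (table-at (half-B sh b) k) (elements u) (elements v) })
      (λ { (sh , b , u , v , k) → table sh u v (twice+ b k % 10) })
      (∈-cartesianProduct⁺ (∈-shapes sh) (∈-cartesianProduct⁺ (∈-bools b)
        (∈-cartesianProduct⁺ (∈-sets u) (∈-cartesianProduct⁺ (∈-sets v) (∈-upTo⁺ k<10)))))
    where
    cases = cartesianProduct shapes (cartesianProduct bools (cartesianProduct sets (cartesianProduct sets (upTo 10))))

  base : ∀ n → n < 4 → Table-on-sets n
  base n n<4 sh u v =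
    by-evaluation cases
      (λ { (n , sh , u , v) → Δ (rows sh n) (cols sh n) (elements u) (elements v) })
      (λ { (n , sh , u , v) → table sh u v (n % 10) })
      (∈-cartesianProduct⁺ (∈-upTo⁺ n<4) (∈-cartesianProduct⁺ (∈-shapes sh)
        (∈-cartesianProduct⁺ (∈-sets u) (∈-sets v))))
    where
    cases = cartesianProduct (upTo 4) (cartesianProduct shapes (cartesianProduct sets sets))

  private
    suc-%10 : ∀ p → suc p % 10 ≡ suc (p % 10) % 10
    suc-%10 p = %-distribˡ-+ 1 p 10

    twice+-%10 : ∀ b p → twice+ b (p % 10) % 10 ≡ twice+ b p % 10
    twice+-%10 false p = sym (%-distribˡ-+ p p 10)
    twice+-%10 true  p = begin
      suc (p % 10 ℕ.+ p % 10) % 10           ≡⟨ suc-%10 (p % 10 ℕ.+ p % 10) ⟩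
      suc ((p % 10 ℕ.+ p % 10) % 10) % 10    ≡⟨ cong (λ x → suc x % 10) (twice+-%10 false p) ⟩
      suc ((p ℕ.+ p) % 10) % 10              ≡⟨ suc-%10 (p ℕ.+ p) ⟨
      suc (p ℕ.+ p) % 10                     ∎
      where open ≡-Reasoning

  step : ∀ p → Table p → Table (suc p) → ∀ b → Table-on-sets (twice+ b p)
  step p T₀ T₁ b sh u v = begin
      Δ r s (elements u) (elements v)
    ≡⟨ Δ-recursion r s (elements u) (elements v) ⟩
      recursion-rhs (Δ ⌈ r /2⌉ ⌊ s /2⌋) (Δ ⌊ r /2⌋ ⌈ s /2⌉) (elements u) (elements v)
    ≡⟨ recursion-rhs-cong (subproblem (half-A sh b) (sizes-A sh b p))
                          (subproblem (half-B sh b) (sizes-B sh b p)) (elements u) (elements v) ⟩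
      recursion-rhs (table-at (half-A sh b) (p % 10)) (table-at (half-B sh b) (p % 10)) (elements u) (elements v)
    ≡⟨ halving-table sh b u v (p % 10) (m%n<n p 10) ⟩
      table sh u v (twice+ b (p % 10) % 10)
    ≡⟨ cong (table sh u v) (twice+-%10 b p) ⟩
      table sh u v (twice+ b p % 10) ∎
    where
    open ≡-Reasoning
    r = rows sh (twice+ b p)
    s = cols sh (twice+ b p)

    subproblem : ∀ A {x y} → (x , y) ≡ (rows (proj₁ A) (at (proj₂ A) p) , cols (proj₁ A) (at (proj₂ A) p)) →
                 ∀ U V → Δ x y U V ≡ table-at A (p % 10) U V
    subproblem (sh′ , false) refl U V = T₀ sh′ U V
    subproblem (sh′ , true)  refl U V = trans (T₁ sh′ U V) (cong (tablê sh′ (set-of U) (set-of V)) (suc-%10 p))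

  -- Strong induction on n; from n = 4 on, both halves p and p + 1 are smaller.
  table-holds : ∀ n → Table n
  table-holds = <-rec Table (λ n IH → from-sets n (on-sets n IH))
    where
    p<p+p : ∀ q → suc (suc q) < suc (suc q) ℕ.+ suc (suc q)
    p<p+p q = m<m+n (suc (suc q)) (s≤s z≤n)

    1+p<p+p : ∀ q → suc (suc (suc q)) < suc (suc q) ℕ.+ suc (suc q)
    1+p<p+p q = s≤s (s≤s (m≤n+m (suc (suc q)) q))

    on-sets : ∀ n → (∀ {m} → m < n → Table m) → Table-on-sets n
    on-sets n IH with parityView n
    ... | even-view 0 = base 0 (s≤s z≤n)
    ... | odd-view  0 = base 1 (s≤s (s≤s z≤n))
    ... | even-view 1 = base 2 (s≤s (s≤s (s≤s z≤n)))
    ... | odd-view  1 = base 3 ≤-refl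
    ... | even-view (suc (suc q)) = step (suc (suc q)) (IH (p<p+p q)) (IH (1+p<p+p q)) false
    ... | odd-view  (suc (suc q)) =
      step (suc (suc q)) (IH (m<n⇒m<1+n (p<p+p q))) (IH (m<n⇒m<1+n (1+p<p+p q))) true

  set-of-elements : ∀ u → set-of (elements u) ≡ just u
  set-of-elements ∅    = refl
  set-of-elements ⟨α⟩  = refl
  set-of-elements ⟨β⟩  = refl
  set-of-elements ⟨αβ⟩ = refl

  table-on-sets : ∀ n → Table-on-sets n
  table-on-sets n sh u v
    rewrite table-holds n sh (elements u) (elements v) | set-of-elements u | set-of-elements v = refl

  as-Δ : ∀ {k} k′ → k ≡ k′ → (M : ℕ → ℕ → ℤ) (φr φc : ℕ → Label) (r s : ℕ) → ∀ {U V} →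
         (∀ x y → oddℤ (M x y) ≡ bordered K-hankel (φr x) (φc y)) →
         map φr (range k′) ≡ map idx (range r) ++ map border V →
         map φc (range k′) ≡ map idx (range s) ++ map border U →
         oddℤ (detℕ k M) ≡ Δ r s U V
  as-Δ {k} k′ refl M φr φc r s agree row-labels col-labels =
    trans (oddℤ-detℕ k M)
    (trans (det₂-cong agree (range k) (range k))
    (trans (sym (det₂-map (bordered K-hankel) φr φc (range k) (range k)))
           (cong₂ (det₂ (bordered K-hankel)) row-labels col-labels)))

  then₁ : ℕ → Border → ℕ → Label
  then₁ n b i = if i <ᵇ n then idx i else border b

  then₂ : ℕ → ℕ → Label
  then₂ n i = if i <ᵇ n then idx i else (if i ≡ᵇ n then border αb else border βb)

  private
    <ᵇ-true : ∀ {i n} → i < n → (i <ᵇ n) ≡ true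
    <ᵇ-true {zero}  {suc n} _       = refl
    <ᵇ-true {suc i} {suc n} (s≤s h) = <ᵇ-true h

    n<ᵇn : ∀ n → (n <ᵇ n) ≡ false
    n<ᵇn zero    = refl
    n<ᵇn (suc n) = n<ᵇn n

    1+n<ᵇn : ∀ n → (suc n <ᵇ n) ≡ false
    1+n<ᵇn zero    = refl
    1+n<ᵇn (suc n) = 1+n<ᵇn n

    n≡ᵇn : ∀ n → (n ≡ᵇ n) ≡ true
    n≡ᵇn zero    = refl
    n≡ᵇn (suc n) = n≡ᵇn n

    1+n≡ᵇn : ∀ n → (suc n ≡ᵇ n) ≡ false
    1+n≡ᵇn zero    = refl
    1+n≡ᵇn (suc n) = 1+n≡ᵇn n

    map-range-< : ∀ n (f : ℕ → Label) → (∀ i → i < n → f i ≡ idx i) → map f (range n) ≡ map idx (range n)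
    map-range-< zero    f f≡idx = refl
    map-range-< (suc n) f f≡idx =
      trans (map-++ f (range n) [ n ])
      (trans (cong₂ _++_ (map-range-< n f (λ i i<n → f≡idx i (m≤n⇒m≤1+n i<n))) (cong [_] (f≡idx n ≤-refl)))
             (sym (map-++ idx (range n) [ n ])))

  labels-idx : ∀ n → map idx (range n) ≡ map idx (range n) ++ map border []
  labels-idx n = sym (++-identityʳ (map idx (range n)))

  labels₁ : ∀ n b → map (then₁ n b) (range (suc n)) ≡ map idx (range n) ++ map border (b ∷ [])
  labels₁ n b =
    trans (map-++ (then₁ n b) (range n) [ n ])
          (cong₂ _++_ (map-range-< n (then₁ n b) (λ i i<n → cong (λ t → if t then idx i else border b) (<ᵇ-true i<n)))
                      (cong (λ t → (if t then idx n else border b) ∷ []) (n<ᵇn n)))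

  labels₂ : ∀ n → map (then₂ n) (range (suc (suc n))) ≡ map idx (range n) ++ map border (αb ∷ βb ∷ [])
  labels₂ n =
    trans (map-++ (then₂ n) (range n ++ [ n ]) [ suc n ])
    (trans (cong (_++ [ then₂ n (suc n) ]) (map-++ (then₂ n) (range n) [ n ]))
    (trans (++-assoc (map (then₂ n) (range n)) [ then₂ n n ] [ then₂ n (suc n) ])
           (cong₂ _++_ (map-range-< n (then₂ n) (λ i i<n →
                          cong (λ t → if t then idx i else (if i ≡ᵇ n then border αb else border βb)) (<ᵇ-true i<n)))
                       (cong₂ (λ t t′ → t ∷ t′ ∷ [])
                         (cong₂ (λ t e → if t then idx n else (if e then border αb else border βb)) (n<ᵇn n) (n≡ᵇn n))
                         (cong₂ (λ t e → if t then idx (suc n) else (if e then border αb else border βb))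
                                (1+n<ᵇn n) (1+n≡ᵇn n))))))

  Mb Mc Md Me Mg Mh Mx My : ℕ → ℕ → ℕ → ℤ
  Mb n i j = if i <ᵇ n
               then (if j <ᵇ n then pf (i ℕ.+ j) else (if j ≡ᵇ n then α i else β i))
               else (if j <ᵇ n then (if i ≡ᵇ n then α j else β j) else + 0)
  Mc n i j = if i <ᵇ n then (if j <ᵇ n then pf (i ℕ.+ j) else α i) else (if j <ᵇ n then α j else + 0)
  Md n i j = if i <ᵇ n then (if j <ᵇ n then pf (i ℕ.+ j) else β i) else (if j <ᵇ n then β j else + 0)
  Me n i j = if i <ᵇ n then (if j <ᵇ n then pf (i ℕ.+ j) else β i) else (if j <ᵇ n then α j else + 0)
  Mg n i j = if j <ᵇ n then pf (i ℕ.+ j) else α i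
  Mh n i j = if j <ᵇ n then pf (i ℕ.+ j) else β i
  Mx n i j = if i <ᵇ n ℕ.+ 1
               then (if j <ᵇ n then pf (i ℕ.+ j) else (if j ≡ᵇ n then α i else β i))
               else (if j <ᵇ n then α j else + 0)
  My n i j = if i <ᵇ n ℕ.+ 1
               then (if j <ᵇ n then pf (i ℕ.+ j) else (if j ≡ᵇ n then α i else β i))
               else (if j <ᵇ n then β j else + 0)

  private
    agree-b : ∀ n x y → oddℤ (Mb n x y) ≡ bordered K-hankel (then₂ n x) (then₂ n y)
    agree-b n x y with x <ᵇ n | y <ᵇ n | x ≡ᵇ n | y ≡ᵇ n
    ... | true  | true  | _     | _     = refl
    ... | true  | false | _     | true  = oddℤ-α x
    ... | true  | false | _     | false = oddℤ-β x
    ... | false | true  | true  | _     = oddℤ-α y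
    ... | false | true  | false | _     = oddℤ-β y
    ... | false | false | true  | true  = refl
    ... | false | false | true  | false = refl
    ... | false | false | false | true  = refl
    ... | false | false | false | false = refl

    agree-c : ∀ n x y → oddℤ (Mc n x y) ≡ bordered K-hankel (then₁ n αb x) (then₁ n αb y)
    agree-c n x y with x <ᵇ n | y <ᵇ n
    ... | true  | true  = refl
    ... | true  | false = oddℤ-α x
    ... | false | true  = oddℤ-α y
    ... | false | false = refl

    agree-d : ∀ n x y → oddℤ (Md n x y) ≡ bordered K-hankel (then₁ n βb x) (then₁ n βb y)
    agree-d n x y with x <ᵇ n | y <ᵇ n
    ... | true  | true  = refl
    ... | true  | false = oddℤ-β x
    ... | false | true  = oddℤ-β y
    ... | false | false = refl

    agree-e : ∀ n x y → oddℤ (Me n x y) ≡ bordered K-hankel (then₁ n αb x) (then₁ n βb y)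
    agree-e n x y with x <ᵇ n | y <ᵇ n
    ... | true  | true  = refl
    ... | true  | false = oddℤ-β x
    ... | false | true  = oddℤ-α y
    ... | false | false = refl

    agree-g : ∀ n x y → oddℤ (Mg n x y) ≡ bordered K-hankel (idx x) (then₁ n αb y)
    agree-g n x y with y <ᵇ n
    ... | true  = refl
    ... | false = oddℤ-α x

    agree-h : ∀ n x y → oddℤ (Mh n x y) ≡ bordered K-hankel (idx x) (then₁ n βb y)
    agree-h n x y with y <ᵇ n
    ... | true  = refl
    ... | false = oddℤ-β x

    agree-x : ∀ n x y → oddℤ (Mx n x y) ≡ bordered K-hankel (then₁ (suc n) αb x) (then₂ n y)
    agree-x n x y rewrite +-comm n 1 with x <ᵇ suc n | y <ᵇ n | y ≡ᵇ n
    ... | true  | true  | _     = refl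
    ... | true  | false | true  = oddℤ-α x
    ... | true  | false | false = oddℤ-β x
    ... | false | true  | _     = oddℤ-α y
    ... | false | false | true  = refl
    ... | false | false | false = refl

    agree-y : ∀ n x y → oddℤ (My n x y) ≡ bordered K-hankel (then₁ (suc n) βb x) (then₂ n y)
    agree-y n x y rewrite +-comm n 1 with x <ᵇ suc n | y <ᵇ n | y ≡ᵇ n
    ... | true  | true  | _     = refl
    ... | true  | false | true  = oddℤ-α x
    ... | true  | false | false = oddℤ-β x
    ... | false | true  | _     = oddℤ-β y
    ... | false | false | true  = refl
    ... | false | false | false = refl

  a-as-Δ : ∀ n → oddℤ (a n) ≡ Δ n n [] []
  a-as-Δ n = as-Δ n refl (λ i j → pf (i ℕ.+ j)) idx idx n n (λ x y → refl) (labels-idx n) (labels-idx n)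

  b-as-Δ : ∀ n → oddℤ (b n) ≡ Δ n n (αb ∷ βb ∷ []) (αb ∷ βb ∷ [])
  b-as-Δ n = as-Δ (suc (suc n)) (+-comm n 2) (Mb n) (then₂ n) (then₂ n) n n (agree-b n) (labels₂ n) (labels₂ n)

  c-as-Δ : ∀ n → oddℤ (c n) ≡ Δ n n (αb ∷ []) (αb ∷ [])
  c-as-Δ n = as-Δ (suc n) (+-comm n 1) (Mc n) (then₁ n αb) (then₁ n αb) n n (agree-c n) (labels₁ n αb) (labels₁ n αb)

  d-as-Δ : ∀ n → oddℤ (d n) ≡ Δ n n (βb ∷ []) (βb ∷ [])
  d-as-Δ n = as-Δ (suc n) (+-comm n 1) (Md n) (then₁ n βb) (then₁ n βb) n n (agree-d n) (labels₁ n βb) (labels₁ n βb)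

  e-as-Δ : ∀ n → oddℤ (e n) ≡ Δ n n (βb ∷ []) (αb ∷ [])
  e-as-Δ n = as-Δ (suc n) (+-comm n 1) (Me n) (then₁ n αb) (then₁ n βb) n n (agree-e n) (labels₁ n αb) (labels₁ n βb)

  g-as-Δ : ∀ n → oddℤ (g n) ≡ Δ (suc n) n (αb ∷ []) []
  g-as-Δ n = as-Δ (suc n) (+-comm n 1) (Mg n) idx (then₁ n αb) (suc n) n (agree-g n) (labels-idx (suc n)) (labels₁ n αb)

  h-as-Δ : ∀ n → oddℤ (h n) ≡ Δ (suc n) n (βb ∷ []) []
  h-as-Δ n = as-Δ (suc n) (+-comm n 1) (Mh n) idx (then₁ n βb) (suc n) n (agree-h n) (labels-idx (suc n)) (labels₁ n βb)

  x-as-Δ : ∀ n → oddℤ (x n) ≡ Δ (suc n) n (αb ∷ βb ∷ []) (αb ∷ [])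
  x-as-Δ n = as-Δ (suc (suc n)) (+-comm n 2) (Mx n) (then₁ (suc n) αb) (then₂ n) (suc n) n (agree-x n)
                  (labels₁ (suc n) αb) (labels₂ n)

  y-as-Δ : ∀ n → oddℤ (y n) ≡ Δ (suc n) n (αb ∷ βb ∷ []) (βb ∷ [])
  y-as-Δ n = as-Δ (suc (suc n)) (+-comm n 2) (My n) (then₁ (suc n) βb) (then₂ n) (suc n) n (agree-y n)
                  (labels₁ (suc n) βb) (labels₂ n)

open Paperfolding
open Mod2 using (∣∣%2; oddℤ)
open import Data.Bool using (if_then_else_)
open import Data.Nat.DivMod using ([m+n]%n≡m%n)
open import Data.Product using (_,_)
open import Data.Integer using (ℤ)
open import Relation.Binary.PropositionalEquality using (trans; cong; module ≡-Reasoning)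

proposition3p2 : (n : ℕ) → 1 ≤ n →
    (∣ a n ∣ % 2 ≡ ind10 (0 ∷ 1 ∷ 2 ∷ 5 ∷ 8 ∷ 9 ∷ []) n)
    × (∣ b n ∣ % 2 ≡ ind10 (2 ∷ 4 ∷ 6 ∷ 8 ∷ []) n)
    × (∣ c n ∣ % 2 ≡ ind10 (1 ∷ 5 ∷ 9 ∷ []) n)
    × (∣ d n ∣ % 2 ≡ ind10 (2 ∷ 3 ∷ 4 ∷ 5 ∷ 6 ∷ 7 ∷ 8 ∷ []) n)
    × (∣ e n ∣ % 2 ≡ ind10 (2 ∷ 5 ∷ 8 ∷ []) n)
    × (∣ g n ∣ % 2 ≡ ind10 (0 ∷ 1 ∷ 8 ∷ 9 ∷ []) n)
    × (∣ h n ∣ % 2 ≡ ind10 (1 ∷ 2 ∷ 4 ∷ 5 ∷ 7 ∷ 8 ∷ []) n)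
    × (∣ x n ∣ % 2 ≡ ind10 (1 ∷ 4 ∷ 5 ∷ 8 ∷ []) n)
    × (∣ y n ∣ % 2 ≡ ind10 (2 ∷ 3 ∷ 4 ∷ 5 ∷ 6 ∷ 7 ∷ []) n)
    × (∣ a (n + 10) ∣ % 2 ≡ ∣ a n ∣ % 2)
proposition3p2 n _ =
    by-table a square ∅ ∅ a-as-Δ n
  , by-table b square ⟨αβ⟩ ⟨αβ⟩ b-as-Δ n , by-table c square ⟨α⟩ ⟨α⟩ c-as-Δ n
  , by-table d square ⟨β⟩ ⟨β⟩ d-as-Δ n   , by-table e square ⟨β⟩ ⟨α⟩ e-as-Δ n
  , by-table g tall ⟨α⟩ ∅ g-as-Δ n       , by-table h tall ⟨β⟩ ∅ h-as-Δ n
  , by-table x tall ⟨αβ⟩ ⟨α⟩ x-as-Δ n    , by-table y tall ⟨αβ⟩ ⟨β⟩ y-as-Δ n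
  , (begin
      ∣ a (n + 10) ∣ % 2                              ≡⟨ by-table a square ∅ ∅ a-as-Δ (n + 10) ⟩
      (if table square ∅ ∅ ((n + 10) % 10) then 1 else 0) ≡⟨ cong (λ k → if table square ∅ ∅ k then 1 else 0) ([m+n]%n≡m%n n 10) ⟩
      (if table square ∅ ∅ (n % 10) then 1 else 0)        ≡⟨ by-table a square ∅ ∅ a-as-Δ n ⟨
      ∣ a n ∣ % 2                                     ∎)
  where
  open ≡-Reasoning

  by-table : ∀ (z : ℕ → ℤ) sh u v → (∀ m → oddℤ (z m) ≡ Δ (rows sh m) (cols sh m) (elements u) (elements v)) →
             ∀ m → ∣ z m ∣ % 2 ≡ (if table sh u v (m % 10) then 1 else 0)
  by-table z sh u v z≡Δ m =
    trans (∣∣%2 (z m)) (cong (λ t → if t then 1 else 0) (trans (z≡Δ m) (table-on-sets m sh u v)))
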